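{- Let $k\ge 4$ and $s$ be positive integers, and suppose $j\in\{(2k-2)/3,(2k-1)/3\}$ is an integer. Then the circle graph $D$ on $n=2sk+1$ vertices determined by $\{js+1,js+2,\ldots,(j+1)s\}$ has no diameter two subgraph on more than $2s+7$ vertices.
   Context: For an integer $n\ge 2$ and a set $S\subseteq\{1,\ldots,\lfloor n/2\rfloor\}$, the circle graph on $n$ vertices determined by $S$ is the graph with vertex set $\{0,1,\ldots,n-1\}$ in which two vertices $x,y$ are adjacent if and only if $(x-y)\bmod n\in S$ or $(y-x)\bmod n\in S$. A diameter two subgraph of a graph $G$ is a subgraph $H$ of $G$ such that for every pair of vertices $x,y$ of $H$ there is a path in $H$ joining $x$ and $y$ with at most two edges. -}

module Defs where

open import Data.Nat using (ℕ; suc; _+_; _*_; _∸_; _≤_; NonZero)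
open import Data.Nat.DivMod using (_%_)
open import Data.Fin using (Fin; toℕ)
open import Data.Fin.Subset using (Subset; _∈_)
open import Data.Product using (Σ; _×_)
open import Data.Sum using (_⊎_)
open import Relation.Binary.PropositionalEquality using (_≡_)

-- The connection set S is given as a predicate on ℕ (a subset of {1,…,⌊n/2⌋}).
-- Vertices of the circle graph on n vertices are Fin n = {0,…,n-1}.
-- x ~ y  iff  (x - y) mod n ∈ S  or  (y - x) mod n ∈ S.
-- (x - y) mod n is computed as (n + x ∸ y) % n, which is correct since x, y < n.
CircleAdj : (n : ℕ) → .{{NonZero n}} → (ℕ → Set) → Fin n → Fin n → Set
CircleAdj n S x y = S ((n + toℕ x ∸ toℕ y) % n) ⊎ S ((n + toℕ y ∸ toℕ x) % n)

record Subgraph (n : ℕ) (Adj : Fin n → Fin n → Set) : Set₁ where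
  field
    V    : Subset n
    E    : Fin n → Fin n → Set
    E-sym  : ∀ {x y} → E x y → E y x
    E-adj  : ∀ {x y} → E x y → Adj x y
    E-V    : ∀ {x y} → E x y → x ∈ V × y ∈ V

DiameterTwo : ∀ {n Adj} → Subgraph n Adj → Set
DiameterTwo H = ∀ x y → x ∈ V → y ∈ V →
  x ≡ y ⊎ E x y ⊎ Σ (Fin _) (λ z → E x z × E z y)
  where open Subgraph H

Interval : ℕ → ℕ → ℕ → Set
Interval j s d = suc (j * s) ≤ d × d ≤ (j + 1) * s

-- Write s = a + 1 and J = j s, and measure each vertex y of H by its position
-- r y = (y − v + a) mod n relative to a fixed vertex v of H. Two vertices of a
-- diameter-two subgraph differ by a residue in ±S, ±(S + S) or S − S, where
-- S = {J+1, …, J+s}. For n = 3J + 2s + 1 and n = 3J + s + 1 these residues lie in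
-- three short windows near 0, J and 2J, so the positions form three clusters, and
-- translating the clusters by multiples of about J folds V injectively into an
-- interval of length 2s or 2s + 1 (this needs J ≥ 3s, i.e. j ≥ 3). In the remaining
-- case j = 2, k = 4 the positions form a cluster near v and a far one, and the far
-- one either splits into two parts that can be folded likewise, or has at most s
-- vertices, as does the near one.
module Submission where

open import Defs
open import Data.Bool.Properties using (T-≡)
open import Data.Empty using (⊥; ⊥-elim)
open import Data.Fin using (Fin; zero; suc; toℕ)
open import Data.Fin.Properties using (any?; toℕ<n; toℕ-injective) renaming (_≟_ to _≟ᶠ_)
open import Data.Fin.Subset using (Subset; _∈_; _-_; _∩_; ∁; ⁅_⁆; ∣_∣; Nonempty; Empty; inside; outside)
open import Data.Fin.Subset.Properties
  using (_∈?_; nonempty?; Empty-unique; ∣⊥∣≡0; p─⊥≡p; p─q⊆p; x∈p∩q⁻; x∈∁p⇒x∉p)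
open import Data.List using ([]; _∷_)
open import Data.Nat using (ℕ; NonZero; zero; suc; _+_; _*_; _∸_; _≤_; _<_; _≤?_; _<?_; _≟_; z≤n; s≤s)
open import Data.Nat.DivMod
  using (_%_; m%n<n; m<n⇒m%n≡m; n%n≡0; [m+n]%n≡m%n; [m+kn]%n≡m%n; %-distribˡ-+; m%n%n≡m%n)
open import Data.Nat.Induction using (<-rec)
open import Data.Nat.Properties
open import Data.Nat.Tactic.RingSolver using (solve; solve-∀)
open import Data.Product using (Σ-syntax; _×_; _,_; proj₁; proj₂)
open import Data.Sum using (_⊎_; inj₁; inj₂)
open import Data.Vec.Properties using (lookup∘tabulate; []=⇒lookup; lookup⇒[]=)
open import Function using (_∘_; Equivalence)
open import Relation.Binary.PropositionalEquality
  using (_≡_; _≢_; refl; sym; trans; cong; cong₂; subst; module ≡-Reasoning)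
open import Relation.Nullary using (¬_; Dec; yes; no)
open import Relation.Nullary.Decidable using (_×-dec_; isYes; toWitness; fromWitness)

-- Linear arithmetic by certificate: sum the hypotheses into p ≤ q; the goal
-- follows as soon as x + q + c and y + p are equal polynomials.
lin-≤ : ∀ {x y p q} c → p ≤ q → x + q + c ≡ y + p → x ≤ y
lin-≤ {x} {y} {p} {q} c p≤q eq = +-cancelʳ-≤ p x y (begin
  x + p      ≤⟨ +-monoʳ-≤ x p≤q ⟩
  x + q      ≤⟨ m≤m+n (x + q) c ⟩
  x + q + c  ≡⟨ eq ⟩
  y + p      ∎)
  where open ≤-Reasoning

lin-⊥ : ∀ {p q} c → p ≤ q → suc (q + c) ≡ p → ⊥
lin-⊥ {p} {q} c p≤q eq = 1+n≰n (≤-trans (s≤s (m≤m+n q c)) (≤-trans (≤-reflexive eq) p≤q))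

lin-≡ : ∀ {x y p q} → p ≡ q → x + q ≡ y + p → x ≡ y
lin-≡ {x} {y} {p} {q} p≡q eq = +-cancelʳ-≡ q x y (trans eq (cong (y +_) p≡q))

infixl 6 _+ᵐ_
_+ᵐ_ : ∀ {a b c d} → a ≤ b → c ≤ d → a + c ≤ b + d
_+ᵐ_ = +-mono-≤

InjectiveOn : ∀ {n} → Subset n → (Fin n → ℕ) → Set
InjectiveOn V h = ∀ x y → x ∈ V → y ∈ V → h x ≡ h y → x ≡ y

-- Vector syntax stays local, so that [] and _∷_ in the solver calls are lists.
module _ where
  open import Data.Vec using ([]; _∷_; here; there; tabulate)

  ∣p∣≡1+∣p-x∣ : ∀ {n x} (p : Subset n) → x ∈ p → ∣ p ∣ ≡ suc ∣ (p - x) ∣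
  ∣p∣≡1+∣p-x∣ {x = zero} (inside ∷ p) here = cong suc (cong ∣_∣ (sym (p─⊥≡p p)))
  ∣p∣≡1+∣p-x∣ {x = suc x} (inside ∷ p) (there x∈p) = cong suc (∣p∣≡1+∣p-x∣ p x∈p)
  ∣p∣≡1+∣p-x∣ {x = suc x} (outside ∷ p) (there x∈p) = ∣p∣≡1+∣p-x∣ p x∈p

  x∈p-y⇒x≢y : ∀ {n} {x y : Fin n} (p : Subset n) → x ∈ p - y → x ≢ y
  x∈p-y⇒x≢y {x = zero} {zero} (_ ∷ p) ()
  x∈p-y⇒x≢y {x = suc x} {suc y} (_ ∷ p) (there x∈p-y) refl = x∈p-y⇒x≢y p x∈p-y refl
  x∈p-y⇒x≢y {x = zero} {suc y} _ _ ()
  x∈p-y⇒x≢y {x = suc x} {zero} _ _ ()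

  subsetOf : ∀ {n} {P : Fin n → Set} → (∀ x → Dec (P x)) → Subset n
  subsetOf P? = tabulate (λ x → isYes (P? x))

  ∈subsetOf⁻ : ∀ {n} {P : Fin n → Set} (P? : ∀ x → Dec (P x)) {x} → x ∈ subsetOf P? → P x
  ∈subsetOf⁻ P? {x} x∈ =
    toWitness {a? = P? x} (Equivalence.from T-≡ (trans (sym (lookup∘tabulate (isYes ∘ P?) x)) ([]=⇒lookup x∈)))

  ∈subsetOf⁺ : ∀ {n} {P : Fin n → Set} (P? : ∀ x → Dec (P x)) {x} → P x → x ∈ subsetOf P?
  ∈subsetOf⁺ P? {x} px =
    lookup⇒[]= x _ (trans (lookup∘tabulate (isYes ∘ P?) x) (Equivalence.to T-≡ (fromWitness {a? = P? x} px)))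

  ∣p∣≡∣p∩q∣+∣p∩∁q∣ : ∀ {n} (p q : Subset n) → ∣ p ∣ ≡ ∣ p ∩ q ∣ + ∣ p ∩ ∁ q ∣
  ∣p∣≡∣p∩q∣+∣p∩∁q∣ [] [] = refl
  ∣p∣≡∣p∩q∣+∣p∩∁q∣ (inside ∷ p) (inside ∷ q) = cong suc (∣p∣≡∣p∩q∣+∣p∩∁q∣ p q)
  ∣p∣≡∣p∩q∣+∣p∩∁q∣ (inside ∷ p) (outside ∷ q) =
    trans (cong suc (∣p∣≡∣p∩q∣+∣p∩∁q∣ p q)) (sym (+-suc ∣ p ∩ q ∣ ∣ p ∩ ∁ q ∣))
  ∣p∣≡∣p∩q∣+∣p∩∁q∣ (outside ∷ p) (_ ∷ q) = ∣p∣≡∣p∩q∣+∣p∩∁q∣ p q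

Empty⇒∣p∣≡0 : ∀ {n} (p : Subset n) → Empty p → ∣ p ∣ ≡ 0
Empty⇒∣p∣≡0 {n} p empty = trans (cong ∣_∣ (Empty-unique empty)) (∣⊥∣≡0 n)

∣p∣≤-injection : ∀ {n} M (V : Subset n) (h : Fin n → ℕ) →
  (∀ x → x ∈ V → h x < M) → InjectiveOn V h → ∣ V ∣ ≤ M
∣p∣≤-injection zero V h h<0 _ = ≤-reflexive (Empty⇒∣p∣≡0 V λ (x , x∈V) → n≮0 (h<0 x x∈V))
∣p∣≤-injection (suc M) V h h≤M inj with any? (λ x → x ∈? V ×-dec h x ≟ M)
... | yes (x , x∈V , hx≡M) = begin
  ∣ V ∣            ≡⟨ ∣p∣≡1+∣p-x∣ V x∈V ⟩
  suc ∣ (V - x) ∣  ≤⟨ s≤s (∣p∣≤-injection M (V - x) h h<M injective) ⟩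
  suc M            ∎
  where
  open ≤-Reasoning
  h<M : ∀ y → y ∈ V - x → h y < M
  h<M y y∈ = ≤∧≢⇒< (m<1+n⇒m≤n (h≤M y (p─q⊆p V ⁅ x ⁆ y∈)))
    λ hy≡M → x∈p-y⇒x≢y V y∈ (inj y x (p─q⊆p V ⁅ x ⁆ y∈) x∈V (trans hy≡M (sym hx≡M)))
  injective : InjectiveOn (V - x) h
  injective y z y∈ z∈ = inj y z (p─q⊆p V ⁅ x ⁆ y∈) (p─q⊆p V ⁅ x ⁆ z∈)
... | no ∄x = m≤n⇒m≤1+n (∣p∣≤-injection M V h h<M inj)
  where
  h<M : ∀ y → y ∈ V → h y < M
  h<M y y∈V = ≤∧≢⇒< (m<1+n⇒m≤n (h≤M y y∈V)) λ hy≡M → ∄x (y , y∈V , hy≡M)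

minimiser : ∀ {n} (V : Subset n) (h : Fin n → ℕ) → Nonempty V →
  Σ[ m ∈ Fin n ] m ∈ V × (∀ y → y ∈ V → h m ≤ h y)
minimiser {n} V h (x , x∈V) = <-rec P descend (h x) x x∈V refl
  where
  P : ℕ → Set
  P k = ∀ x → x ∈ V → h x ≡ k → Σ[ m ∈ Fin n ] m ∈ V × (∀ y → y ∈ V → h m ≤ h y)
  descend : ∀ k → (∀ {j} → j < k → P j) → P k
  descend _ rec x x∈V refl with any? (λ y → y ∈? V ×-dec h y <? h x)
  ... | yes (y , y∈V , hy<hx) = rec hy<hx y y∈V refl
  ... | no ∄y = x , x∈V , λ y y∈V → ≮⇒≥ λ hy<hx → ∄y (y , y∈V , hy<hx)

∣p∣≤-spread : ∀ {n} D (V : Subset n) (h : Fin n → ℕ) →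
  (∀ x y → x ∈ V → y ∈ V → h y ≤ h x + D) → InjectiveOn V h → ∣ V ∣ ≤ suc D
∣p∣≤-spread D V h spread inj with nonempty? V
... | no empty = ≤-trans (≤-reflexive (Empty⇒∣p∣≡0 V empty)) z≤n
... | yes ne with minimiser V h ne
... | m , m∈V , minimal = ∣p∣≤-injection (suc D) V (λ y → h y ∸ h m) below injective
  where
  below : ∀ y → y ∈ V → h y ∸ h m < suc D
  below y y∈V = s≤s (≤-trans (∸-monoˡ-≤ (h m) (spread m y m∈V y∈V)) (≤-reflexive (m+n∸m≡n (h m) D)))
  injective : InjectiveOn V (λ y → h y ∸ h m)
  injective x y x∈V y∈V eq = inj x y x∈V y∈V (∸-cancelʳ-≡ (minimal x x∈V) (minimal y y∈V) eq)

Close : ℕ → ℕ → ℕ → Set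
Close D x y = (x < y × y ≤ x + D) ⊎ (y < x × x ≤ y + D)

Close-sym : ∀ {D x y} → Close D x y → Close D y x
Close-sym (inj₁ c) = inj₂ c
Close-sym (inj₂ c) = inj₁ c

Close-shift : ∀ {D x y} k → Close D x y → Close D (x + k) (y + k)
Close-shift {D} {x} {y} k (inj₁ (x<y , y≤x+D)) =
  inj₁ (lin-≤ 0 x<y (solve (x ∷ y ∷ k ∷ [])) , lin-≤ 0 y≤x+D (solve (x ∷ y ∷ k ∷ D ∷ [])))
Close-shift {D} {x} {y} k (inj₂ (y<x , x≤y+D)) =
  inj₂ (lin-≤ 0 y<x (solve (x ∷ y ∷ k ∷ [])) , lin-≤ 0 x≤y+D (solve (x ∷ y ∷ k ∷ D ∷ [])))

∣p∣≤-close : ∀ {n} D (V : Subset n) (h : Fin n → ℕ) →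
  (∀ x y → x ∈ V → y ∈ V → x ≢ y → Close D (h x) (h y)) → ∣ V ∣ ≤ suc D
∣p∣≤-close D V h close = ∣p∣≤-spread D V h spread injective
  where
  spread : ∀ x y → x ∈ V → y ∈ V → h y ≤ h x + D
  spread x y x∈V y∈V with x ≟ᶠ y
  ... | yes refl = m≤m+n (h x) D
  ... | no x≢y with close x y x∈V y∈V x≢y
  ...   | inj₁ (_ , hy≤hx+D) = hy≤hx+D
  ...   | inj₂ (hy<hx , _) = ≤-trans (<⇒≤ hy<hx) (m≤m+n (h x) D)
  injective : InjectiveOn V h
  injective x y x∈V y∈V hx≡hy with x ≟ᶠ y
  ... | yes x≡y = x≡y
  ... | no x≢y with close x y x∈V y∈V x≢y
  ...   | inj₁ (hx<hy , _) = ⊥-elim (<-irrefl hx≡hy hx<hy)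
  ...   | inj₂ (hy<hx , _) = ⊥-elim (<-irrefl (sym hx≡hy) hy<hx)

module _ {n : ℕ} .{{_ : NonZero n}} where

  [m%n+k]%n≡[m+k]%n : ∀ m k → ((m % n) + k) % n ≡ (m + k) % n
  [m%n+k]%n≡[m+k]%n m k = begin
    ((m % n) + k) % n          ≡⟨ %-distribˡ-+ (m % n) k n ⟩
    (m % n % n + k % n) % n    ≡⟨ cong (λ u → (u + k % n) % n) (m%n%n≡m%n m n) ⟩
    (m % n + k % n) % n        ≡⟨ %-distribˡ-+ m k n ⟨
    (m + k) % n                ∎
    where open ≡-Reasoning

  -- If the sum wrapped around, its residue would be smaller than a.
  %-no-wrap : ∀ {a b c} → a < n → b < n → (a + b) % n ≡ c → a ≤ c → a + b ≡ c
  %-no-wrap {a} {b} {c} a<n b<n sum≡c a≤c with a + b <? n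
  ... | yes a+b<n = trans (sym (m<n⇒m%n≡m a+b<n)) sum≡c
  ... | no a+b≮n with m≤n⇒∃[o]m+o≡n (≮⇒≥ a+b≮n)
  ...   | c′ , n+c′≡a+b = ⊥-elim (lin-⊥ 0 (a≤c +ᵐ ≤-reflexive (sym c′≡c) +ᵐ b<n +ᵐ ≤-reflexive n+c′≡a+b)
          (solve (a ∷ b ∷ c ∷ c′ ∷ n ∷ [])))
    where
    c′<n : c′ < n
    c′<n = lin-≤ 1 (≤-reflexive n+c′≡a+b +ᵐ a<n +ᵐ b<n) (solve (a ∷ b ∷ c′ ∷ n ∷ []))
    c′≡c : c′ ≡ c
    c′≡c = begin
      c′              ≡⟨ m<n⇒m%n≡m c′<n ⟨
      c′ % n          ≡⟨ [m+n]%n≡m%n c′ n ⟨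
      (c′ + n) % n    ≡⟨ cong (_% n) (trans (+-comm c′ n) n+c′≡a+b) ⟩
      (a + b) % n     ≡⟨ sum≡c ⟩
      c               ∎
      where open ≡-Reasoning

  %-≡ : ∀ {x c} → x ≡ c + n → c < n → x % n ≡ c
  %-≡ {x} {c} x≡c+n c<n = trans (cong (_% n) x≡c+n) (trans ([m+n]%n≡m%n c n) (m<n⇒m%n≡m c<n))

lifts-sum : ∀ {p q x y n} → p + y ≡ x → q + x ≡ y + n → p + q ≡ n
lifts-sum {p} {q} {x} {y} {n} e₁ e₂ = +-cancelʳ-≡ (x + y) (p + q) n (begin
  p + q + (x + y)    ≡⟨ solve (p ∷ q ∷ x ∷ y ∷ []) ⟩
  (p + y) + (q + x)  ≡⟨ cong₂ _+_ e₁ e₂ ⟩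
  x + (y + n)        ≡⟨ solve (x ∷ y ∷ n ∷ []) ⟩
  n + (x + y)        ∎)
  where open ≡-Reasoning

lifts-add : ∀ p q r x y z c₁ c₂ c₃ n →
  p + y ≡ x + c₁ * n → q + z ≡ y + c₂ * n → r + z ≡ x + c₃ * n →
  p + q + c₃ * n ≡ r + (c₁ + c₂) * n
lifts-add p q r x y z c₁ c₂ c₃ n e₁ e₂ e₃ =
  +-cancelʳ-≡ (y + z) (p + q + c₃ * n) (r + (c₁ + c₂) * n) (begin
    p + q + c₃ * n + (y + z)            ≡⟨ solve (p ∷ q ∷ y ∷ z ∷ c₃ ∷ n ∷ []) ⟩
    (p + y) + (q + z) + c₃ * n          ≡⟨ cong (_+ c₃ * n) (cong₂ _+_ e₁ e₂) ⟩
    (x + c₁ * n) + (y + c₂ * n) + c₃ * n  ≡⟨ solve (x ∷ y ∷ c₁ ∷ c₂ ∷ c₃ ∷ n ∷ []) ⟩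
    (x + c₃ * n) + y + (c₁ + c₂) * n    ≡⟨ cong (λ u → u + y + (c₁ + c₂) * n) e₃ ⟨
    (r + z) + y + (c₁ + c₂) * n         ≡⟨ solve (r ∷ y ∷ z ∷ c₁ ∷ c₂ ∷ n ∷ []) ⟩
    r + (c₁ + c₂) * n + (y + z)         ∎)
  where open ≡-Reasoning

InS : ℕ → ℕ → ℕ → Set
InS J s e = J < e × e ≤ J + s

Interval⇒InS : ∀ {j s d} → Interval j s d → InS (j * s) s d
Interval⇒InS {j} {s} {d} (lower , upper) = lower , subst (d ≤_) [j+1]*s≡j*s+s upper
  where
  [j+1]*s≡j*s+s : (j + 1) * s ≡ j * s + s
  [j+1]*s≡j*s+s = solve (j ∷ s ∷ [])

OneStep : ℕ → ℕ → ℕ → ℕ → Set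
OneStep n J s d = InS J s d ⊎ Σ[ e ∈ ℕ ] InS J s e × d + e ≡ n

-- The residues δ z y of two vertices at distance at most two: ±S, ±(S + S)
-- and S − S = (−s, s), where S = {J+1, …, J+s}.
data TwoStep (n J s d : ℕ) : Set where
  S¹  : InS J s d → TwoStep n J s d
  S¹⁻ : ∀ e → InS J s e → d + e ≡ n → TwoStep n J s d
  S²  : ∀ e₁ e₂ → InS J s e₁ → InS J s e₂ → d ≡ e₁ + e₂ → TwoStep n J s d
  S²⁻ : ∀ e₁ e₂ → InS J s e₁ → InS J s e₂ → d + (e₁ + e₂) ≡ n → TwoStep n J s d
  S⁰  : d < s → TwoStep n J s d
  S⁰⁻ : n < d + s → TwoStep n J s d

-- Seen from a vertex at position a: the residues between vertices (Window), the
-- positions of vertices (Region), and a fold bringing V into a window of width spread.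
record Folding (n J a : ℕ) : Set₁ where
  field
    Window Region : ℕ → Set
    window        : ∀ {d} → TwoStep n J (suc a) d → Window d
    region-near   : ∀ {x} → x ≤ a → Region x
    region        : ∀ {x d} → x < n → a + d ≡ x → Window d → Region x
    fold          : ℕ → ℕ
    spread        : ℕ
    fold-close    : ∀ {x y d} → x + d ≡ y → 0 < d → Region x → Region y → Window d →
                    Close spread (fold x) (fold y)

module Circular (n : ℕ) .{{_ : NonZero n}} where

  abstract
    δ : Fin n → Fin n → ℕ
    δ x y = (n + toℕ x ∸ toℕ y) % n

    δ<n : ∀ x y → δ x y < n
    δ<n x y = m%n<n (n + toℕ x ∸ toℕ y) n

    δ-self : ∀ x → δ x x ≡ 0
    δ-self x = trans (cong (_% n) (m+n∸n≡m n (toℕ x))) (n%n≡0 n)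

    δ-lift : ∀ x y → (toℕ y ≤ toℕ x × δ x y + toℕ y ≡ toℕ x)
                   ⊎ (toℕ x < toℕ y × δ x y + toℕ y ≡ toℕ x + n)
    δ-lift x y with ≤-<-connex (toℕ y) (toℕ x)
    ... | inj₁ y≤x = inj₁ (y≤x , (begin
      δ x y + toℕ y                      ≡⟨ cong (λ u → u % n + toℕ y) (+-∸-assoc n y≤x) ⟩
      (n + (toℕ x ∸ toℕ y)) % n + toℕ y  ≡⟨ cong (λ u → u % n + toℕ y) (+-comm n (toℕ x ∸ toℕ y)) ⟩
      (toℕ x ∸ toℕ y + n) % n + toℕ y    ≡⟨ cong (_+ toℕ y) ([m+n]%n≡m%n (toℕ x ∸ toℕ y) n) ⟩
      (toℕ x ∸ toℕ y) % n + toℕ y        ≡⟨ cong (_+ toℕ y) (m<n⇒m%n≡m x∸y<n) ⟩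
      (toℕ x ∸ toℕ y) + toℕ y            ≡⟨ m∸n+n≡m y≤x ⟩
      toℕ x                              ∎))
      where
      open ≡-Reasoning
      x∸y<n : toℕ x ∸ toℕ y < n
      x∸y<n = ≤-<-trans (m∸n≤m (toℕ x) (toℕ y)) (toℕ<n x)
    ... | inj₂ x<y = inj₂ (x<y , (begin
      δ x y + toℕ y                  ≡⟨ cong (_+ toℕ y) (m<n⇒m%n≡m wrapped<n) ⟩
      (n + toℕ x ∸ toℕ y) + toℕ y    ≡⟨ m∸n+n≡m y≤n+x ⟩
      n + toℕ x                      ≡⟨ +-comm n (toℕ x) ⟩
      toℕ x + n                      ∎))
      where
      open ≡-Reasoning
      y≤n+x : toℕ y ≤ n + toℕ x
      y≤n+x = ≤-trans (<⇒≤ (toℕ<n y)) (m≤m+n n (toℕ x))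
      wrapped<n : n + toℕ x ∸ toℕ y < n
      wrapped<n = subst (n + toℕ x ∸ toℕ y <_) (m+n∸n≡m n (toℕ x)) (∸-monoʳ-< x<y y≤n+x)

    CircleAdj⇒δ : ∀ {S x y} → CircleAdj n S x y → S (δ x y) ⊎ S (δ y x)
    CircleAdj⇒δ adj = adj

  δ≡0⇒≡ : ∀ x y → δ x y ≡ 0 → x ≡ y
  δ≡0⇒≡ x y δ≡0 with δ-lift x y
  ... | inj₁ (_ , eq) = toℕ-injective (trans (sym eq) (cong (_+ toℕ y) δ≡0))
  ... | inj₂ (_ , eq) = ⊥-elim (<⇒≱ (toℕ<n y)
          (subst (n ≤_) (trans (sym eq) (cong (_+ toℕ y) δ≡0)) (m≤n+m n (toℕ x))))

  δ+δ≡n : ∀ x y → x ≢ y → δ x y + δ y x ≡ n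
  δ+δ≡n x y x≢y with δ-lift x y | δ-lift y x
  ... | inj₁ (y≤x , _) | inj₁ (x≤y , _) = ⊥-elim (x≢y (toℕ-injective (≤-antisym x≤y y≤x)))
  ... | inj₂ (x<y , _) | inj₂ (y<x , _) = ⊥-elim (<-asym x<y y<x)
  ... | inj₁ (_ , e₁) | inj₂ (_ , e₂) = lifts-sum e₁ e₂
  ... | inj₂ (_ , e₁) | inj₁ (_ , e₂) = trans (+-comm (δ x y) (δ y x)) (lifts-sum e₂ e₁)

  δ-lift-∃ : ∀ x y → Σ[ c ∈ ℕ ] δ x y + toℕ y ≡ toℕ x + c * n
  δ-lift-∃ x y with δ-lift x y
  ... | inj₁ (_ , eq) = 0 , trans eq (sym (+-identityʳ (toℕ x)))
  ... | inj₂ (_ , eq) = 1 , trans eq (cong (toℕ x +_) (sym (*-identityˡ n)))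

  δ-add : ∀ x y z → δ x z ≡ (δ x y + δ y z) % n
  δ-add x y z with δ-lift-∃ x y | δ-lift-∃ y z | δ-lift-∃ x z
  ... | c₁ , e₁ | c₂ , e₂ | c₃ , e₃ = begin
    δ x z                        ≡⟨ m<n⇒m%n≡m (δ<n x z) ⟨
    δ x z % n                    ≡⟨ [m+kn]%n≡m%n (δ x z) (c₁ + c₂) n ⟨
    (δ x z + (c₁ + c₂) * n) % n  ≡⟨ cong (_% n) lifted ⟨
    (δ x y + δ y z + c₃ * n) % n ≡⟨ [m+kn]%n≡m%n (δ x y + δ y z) c₃ n ⟩
    (δ x y + δ y z) % n          ∎
    where
    open ≡-Reasoning
    lifted : δ x y + δ y z + c₃ * n ≡ δ x z + (c₁ + c₂) * n
    lifted = lifts-add (δ x y) (δ y z) (δ x z) (toℕ x) (toℕ y) (toℕ z) c₁ c₂ c₃ n e₁ e₂ e₃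

  -- The shift by a gives the vertices within distance a of v the positions [0, 2a].
  module Frame (v : Fin n) (a : ℕ) (a<n : a < n) where

    abstract
      r : Fin n → ℕ
      r y = (δ y v + a) % n

      r<n : ∀ y → r y < n
      r<n y = m%n<n (δ y v + a) n

      r-v : r v ≡ a
      r-v = trans (cong (λ u → (u + a) % n) (δ-self v)) (m<n⇒m%n≡m a<n)

      r-shift : ∀ y z → (r y + δ z y) % n ≡ r z
      r-shift y z = begin
        ((δ y v + a) % n + δ z y) % n     ≡⟨ [m%n+k]%n≡[m+k]%n (δ y v + a) (δ z y) ⟩
        (δ y v + a + δ z y) % n           ≡⟨ cong (_% n) (rearrange (δ y v) a (δ z y)) ⟩
        ((δ z y + δ y v) + a) % n         ≡⟨ [m%n+k]%n≡[m+k]%n (δ z y + δ y v) a ⟨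
        ((δ z y + δ y v) % n + a) % n     ≡⟨ cong (λ u → (u + a) % n) (δ-add z y v) ⟨
        (δ z v + a) % n                   ∎
        where
        open ≡-Reasoning
        rearrange : ∀ p a q → p + a + q ≡ q + p + a
        rearrange = solve-∀

    r-diff : ∀ y z → r y ≤ r z → r y + δ z y ≡ r z
    r-diff y z = %-no-wrap (r<n y) (δ<n z y) (r-shift y z)

    r-injective : ∀ y z → r y ≡ r z → y ≡ z
    r-injective y z ry≡rz = sym (δ≡0⇒≡ z y (+-cancelˡ-≡ (r y) (δ z y) 0
      (trans (r-diff y z (≤-reflexive ry≡rz)) (trans (sym ry≡rz) (sym (+-identityʳ (r y)))))))

  one-step : ∀ {J s} x y → InS J s (δ x y) ⊎ InS J s (δ y x) → OneStep n J s (δ x y)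
  one-step x y (inj₁ d∈S) = inj₁ d∈S
  one-step {J} x y (inj₂ d∈S) = inj₂ (δ y x , d∈S , δ+δ≡n x y x≢y)
    where
    x≢y : x ≢ y
    x≢y refl = n≮0 (subst (J <_) (δ-self x) (proj₁ d∈S))

  step-S-S⁻ : ∀ {J s a b} → a < n → InS J s a → Σ[ e ∈ ℕ ] InS J s e × b + e ≡ n →
    TwoStep n J s ((a + b) % n)
  step-S-S⁻ {J} {s} {a} {b} a<n (J<a , a≤J+s) (e , (J<e , e≤J+s) , b+e≡n) with ≤-<-connex e a
  ... | inj₁ e≤a with m≤n⇒∃[o]m+o≡n e≤a
  ...   | c , e+c≡a = subst (TwoStep n J s) (sym (%-≡ a+b≡c+n c<n)) (S⁰ c<s)
    where
    a+b≡c+n : a + b ≡ c + n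
    a+b≡c+n = lin-≡ (cong₂ _+_ (sym e+c≡a) b+e≡n) (solve (a ∷ b ∷ c ∷ e ∷ n ∷ []))
    c<n : c < n
    c<n = lin-≤ e (a<n +ᵐ ≤-reflexive e+c≡a) (solve (a ∷ c ∷ e ∷ n ∷ []))
    c<s : c < s
    c<s = lin-≤ 0 (J<e +ᵐ a≤J+s +ᵐ ≤-reflexive e+c≡a) (solve (J ∷ s ∷ a ∷ c ∷ e ∷ []))
  step-S-S⁻ {J} {s} {a} {b} a<n (J<a , a≤J+s) (e , (J<e , e≤J+s) , b+e≡n) | inj₂ a<e =
    subst (TwoStep n J s) (sym (m<n⇒m%n≡m a+b<n)) (S⁰⁻ n<a+b+s)
    where
    a+b<n : a + b < n
    a+b<n = lin-≤ 0 (a<e +ᵐ ≤-reflexive b+e≡n) (solve (a ∷ b ∷ e ∷ n ∷ []))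
    n<a+b+s : n < a + b + s
    n<a+b+s = lin-≤ 0 (e≤J+s +ᵐ J<a +ᵐ ≤-reflexive (sym b+e≡n)) (solve (J ∷ s ∷ a ∷ b ∷ e ∷ n ∷ []))

  two-steps : ∀ {J s a b} → J + s + (J + s) < n → a < n → b < n →
    OneStep n J s a → OneStep n J s b → TwoStep n J s ((a + b) % n)
  two-steps {J} {s} {a} {b} S+S<n a<n b<n (inj₁ a∈S) (inj₁ b∈S) =
    subst (TwoStep n J s) (sym (m<n⇒m%n≡m (≤-<-trans (proj₂ a∈S +ᵐ proj₂ b∈S) S+S<n))) (S² a b a∈S b∈S refl)
  two-steps S+S<n a<n b<n (inj₁ a∈S) (inj₂ b∈-S) = step-S-S⁻ a<n a∈S b∈-S
  two-steps {J} {s} {a} {b} S+S<n a<n b<n (inj₂ a∈-S) (inj₁ b∈S) =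
    subst (λ u → TwoStep n J s (u % n)) (+-comm b a) (step-S-S⁻ b<n b∈S a∈-S)
  two-steps {J} {s} {a} {b} S+S<n a<n b<n (inj₂ (e₁ , e₁∈S , a+e₁≡n)) (inj₂ (e₂ , e₂∈S , b+e₂≡n))
    with m≤n⇒∃[o]m+o≡n (<⇒≤ (≤-<-trans (proj₂ e₁∈S +ᵐ proj₂ e₂∈S) S+S<n))
  ... | c , e₁+e₂+c≡n =
    subst (TwoStep n J s) (sym (%-≡ a+b≡c+n c<n)) (S²⁻ e₁ e₂ e₁∈S e₂∈S (trans (+-comm c (e₁ + e₂)) e₁+e₂+c≡n))
    where
    a+b≡c+n : a + b ≡ c + n
    a+b≡c+n = lin-≡ (cong₂ _+_ (cong₂ _+_ a+e₁≡n b+e₂≡n) (sym e₁+e₂+c≡n))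
                    (solve (a ∷ b ∷ c ∷ e₁ ∷ e₂ ∷ n ∷ []))
    c<n : c < n
    c<n = lin-≤ (J + e₂) (proj₁ e₁∈S +ᵐ ≤-reflexive e₁+e₂+c≡n) (solve (J ∷ c ∷ e₁ ∷ e₂ ∷ n ∷ []))

  adjacent : ∀ j s x y → CircleAdj n (Interval j s) x y →
    InS (j * s) s (δ x y) ⊎ InS (j * s) s (δ y x)
  adjacent j s x y adj with CircleAdj⇒δ {Interval j s} {x} {y} adj
  ... | inj₁ d∈S = inj₁ (Interval⇒InS {j} {s} d∈S)
  ... | inj₂ d∈S = inj₂ (Interval⇒InS {j} {s} d∈S)

  diameter-two⇒TwoStep : ∀ {j s} (H : Subgraph n (CircleAdj n (Interval j s))) → DiameterTwo H →
    j * s + s + (j * s + s) < n →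
    ∀ y z → y ∈ Subgraph.V H → z ∈ Subgraph.V H → y ≢ z → TwoStep n (j * s) s (δ z y)
  diameter-two⇒TwoStep {j} {s} H diameter-two S+S<n y z y∈V z∈V y≢z with diameter-two z y z∈V y∈V
  ... | inj₁ z≡y = ⊥-elim (y≢z (sym z≡y))
  ... | inj₂ (inj₁ zy) with one-step z y (adjacent j s z y (Subgraph.E-adj H zy))
  ...   | inj₁ d∈S = S¹ d∈S
  ...   | inj₂ (e , e∈S , d+e≡n) = S¹⁻ e e∈S d+e≡n
  diameter-two⇒TwoStep {j} {s} H diameter-two S+S<n y z y∈V z∈V y≢z | inj₂ (inj₂ (w , zw , wy)) =
    subst (TwoStep n _ _) (sym (δ-add z w y))
      (two-steps S+S<n (δ<n z w) (δ<n w y) (one-step z w (adjacent j s z w (Subgraph.E-adj H zw)))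
                                               (one-step w y (adjacent j s w y (Subgraph.E-adj H wy))))


  module Around (V : Subset n) (v : Fin n) (v∈V : v ∈ V) {J a : ℕ} (a<n : a < n)
    (two-step : ∀ y z → y ∈ V → z ∈ V → y ≢ z → TwoStep n J (suc a) (δ z y)) where

    open Frame v a a<n public

    pair : ∀ y z → y ∈ V → z ∈ V → r y ≤ r z → y ≢ z →
      Σ[ d ∈ ℕ ] r y + d ≡ r z × 0 < d × TwoStep n J (suc a) d
    pair y z y∈V z∈V ry≤rz y≢z =
      δ z y , r-diff y z ry≤rz , n≢0⇒n>0 (y≢z ∘ sym ∘ δ≡0⇒≡ z y) , two-step y z y∈V z∈V y≢z

    seen-from-v : ∀ y → y ∈ V → r y ≤ a ⊎ Σ[ d ∈ ℕ ] a + d ≡ r y × TwoStep n J (suc a) d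
    seen-from-v y y∈V with r y ≤? a
    ... | yes ry≤a = inj₁ ry≤a
    ... | no ry≰a with pair v y v∈V y∈V (≤-trans (≤-reflexive r-v) (<⇒≤ (≰⇒> ry≰a))) v≢y
      where
      v≢y : v ≢ y
      v≢y refl = ry≰a (≤-reflexive r-v)
    ...   | d , rv+d≡ry , _ , t = inj₂ (d , trans (cong (_+ d) (sym r-v)) rv+d≡ry , t)

    ∣V∣≤-ordered-close : ∀ (h : Fin n → ℕ) D →
      (∀ y z → y ∈ V → z ∈ V → r y ≤ r z → y ≢ z → Close D (h y) (h z)) → ∣ V ∣ ≤ suc D
    ∣V∣≤-ordered-close h D close = ∣p∣≤-close D V h close′
      where
      close′ : ∀ y z → y ∈ V → z ∈ V → y ≢ z → Close D (h y) (h z)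
      close′ y z y∈V z∈V y≢z with ≤-total (r y) (r z)
      ... | inj₁ ry≤rz = close y z y∈V z∈V ry≤rz y≢z
      ... | inj₂ rz≤ry = Close-sym (close z y z∈V y∈V rz≤ry (y≢z ∘ sym))

    position : ∀ {Window Region : ℕ → Set} →
      (∀ {d} → TwoStep n J (suc a) d → Window d) → (∀ {x} → x ≤ a → Region x) →
      (∀ {x d} → x < n → a + d ≡ x → Window d → Region x) → ∀ y → y ∈ V → Region (r y)
    position window region-near region y y∈V with seen-from-v y y∈V
    ... | inj₁ ry≤a = region-near ry≤a
    ... | inj₂ (d , a+d≡ry , t) = region (r<n y) a+d≡ry (window t)

    ∣V∣≤-folding : (F : Folding n J a) → ∣ V ∣ ≤ suc (Folding.spread F)
    ∣V∣≤-folding F = ∣V∣≤-ordered-close (fold ∘ r) spread close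
      where
      open Folding F
      close : ∀ y z → y ∈ V → z ∈ V → r y ≤ r z → y ≢ z → Close spread (fold (r y)) (fold (r z))
      close y z y∈V z∈V ry≤rz y≢z with pair y z y∈V z∈V ry≤rz y≢z
      ... | d , ry+d≡rz , 0<d , t = fold-close ry+d≡rz 0<d
        (position window region-near region y y∈V) (position window region-near region z z∈V) (window t)

    ∣W∣≤-cluster : ∀ (W : Subset n) →
      (∀ y z → y ∈ W → z ∈ W → r y ≤ r z → y ≢ z → r z ≤ r y + a) → ∣ W ∣ ≤ suc a
    ∣W∣≤-cluster W within = ∣p∣≤-spread a W r spread (λ y z _ _ → r-injective y z)
      where
      spread : ∀ y z → y ∈ W → z ∈ W → r z ≤ r y + a
      spread y z y∈W z∈W with y ≟ᶠ z
      ... | yes refl = m≤m+n (r y) a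
      ... | no y≢z with ≤-total (r y) (r z)
      ...   | inj₁ ry≤rz = within y z y∈W z∈W ry≤rz y≢z
      ...   | inj₂ rz≤ry = ≤-trans rz≤ry (m≤m+n (r y) a)

module Case-2k-2 {n J a : ℕ} (n≡ : n ≡ J + J + J + a + a + 3) where

  data Window (d : ℕ) : Set where
    w₀  : d ≤ a → Window d
    w₀⁻ : J + J + J + a + 2 < d → Window d
    w₁  : J < d → d ≤ J + a + a + 1 → Window d
    w₂  : J + J + 1 < d → d ≤ J + J + a + a + 2 → Window d

  window : ∀ {d} → TwoStep n J (suc a) d → Window d
  window {d} (S¹ (J<d , d≤J+s)) = w₁ J<d (lin-≤ a d≤J+s (solve (d ∷ J ∷ a ∷ [])))
  window {d} (S¹⁻ e (J<e , e≤J+s) d+e≡n) =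
    w₂ (lin-≤ a (e≤J+s +ᵐ ≤-reflexive (sym d+e≡n) +ᵐ ≤-reflexive (sym n≡)) (solve (d ∷ e ∷ n ∷ J ∷ a ∷ [])))
       (lin-≤ 0 (J<e +ᵐ ≤-reflexive d+e≡n +ᵐ ≤-reflexive n≡) (solve (d ∷ e ∷ n ∷ J ∷ a ∷ [])))
  window {d} (S² e₁ e₂ (J<e₁ , e₁≤J+s) (J<e₂ , e₂≤J+s) d≡e₁+e₂) =
    w₂ (lin-≤ 0 (J<e₁ +ᵐ J<e₂ +ᵐ ≤-reflexive (sym d≡e₁+e₂)) (solve (d ∷ e₁ ∷ e₂ ∷ J ∷ [])))
       (lin-≤ 0 (e₁≤J+s +ᵐ e₂≤J+s +ᵐ ≤-reflexive d≡e₁+e₂) (solve (d ∷ e₁ ∷ e₂ ∷ J ∷ a ∷ [])))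
  window {d} (S²⁻ e₁ e₂ (J<e₁ , e₁≤J+s) (J<e₂ , e₂≤J+s) d+e≡n) =
    w₁ (lin-≤ 0 (e₁≤J+s +ᵐ e₂≤J+s +ᵐ ≤-reflexive (sym d+e≡n) +ᵐ ≤-reflexive (sym n≡))
         (solve (d ∷ e₁ ∷ e₂ ∷ n ∷ J ∷ a ∷ [])))
       (lin-≤ 0 (J<e₁ +ᵐ J<e₂ +ᵐ ≤-reflexive d+e≡n +ᵐ ≤-reflexive n≡)
         (solve (d ∷ e₁ ∷ e₂ ∷ n ∷ J ∷ a ∷ [])))
  window (S⁰ d<s) = w₀ (m<1+n⇒m≤n d<s)
  window {d} (S⁰⁻ n<d+s) = w₀⁻ (lin-≤ 0 (n<d+s +ᵐ ≤-reflexive (sym n≡)) (solve (d ∷ n ∷ J ∷ a ∷ [])))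

  a<n : a < n
  a<n = lin-≤ (J + J + J + a + 2) (≤-reflexive (sym n≡)) (solve (n ∷ J ∷ a ∷ []))

  S+S<n : J + suc a + (J + suc a) < n
  S+S<n = lin-≤ J (≤-reflexive (sym n≡)) (solve (n ∷ J ∷ a ∷ []))

  data Region (x : ℕ) : Set where
    r₀ : x ≤ a + a → Region x
    r₁ : J + a < x → x ≤ J + a + a + a + 1 → Region x
    r₂ : J + J + a + 1 < x → x ≤ J + J + a + a + a + 2 → Region x

  region-near : ∀ {x} → x ≤ a → Region x
  region-near {x} x≤a = r₀ (lin-≤ a x≤a (solve (x ∷ a ∷ [])))

  region : ∀ {x d} → x < n → a + d ≡ x → Window d → Region x
  region {x} {d} _ a+d≡x (w₀ d≤a) = r₀ (lin-≤ 0 (d≤a +ᵐ ≤-reflexive (sym a+d≡x)) (solve (x ∷ d ∷ a ∷ [])))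
  region {x} {d} x<n a+d≡x (w₀⁻ d-large) = ⊥-elim
    (lin-⊥ 0 (d-large +ᵐ x<n +ᵐ ≤-reflexive a+d≡x +ᵐ ≤-reflexive n≡) (solve (x ∷ d ∷ n ∷ J ∷ a ∷ [])))
  region {x} {d} _ a+d≡x (w₁ lower upper) =
    r₁ (lin-≤ 0 (lower +ᵐ ≤-reflexive a+d≡x) (solve (x ∷ d ∷ J ∷ a ∷ [])))
       (lin-≤ 0 (upper +ᵐ ≤-reflexive (sym a+d≡x)) (solve (x ∷ d ∷ J ∷ a ∷ [])))
  region {x} {d} _ a+d≡x (w₂ lower upper) =
    r₂ (lin-≤ 0 (lower +ᵐ ≤-reflexive a+d≡x) (solve (x ∷ d ∷ J ∷ a ∷ [])))
       (lin-≤ 0 (upper +ᵐ ≤-reflexive (sym a+d≡x)) (solve (x ∷ d ∷ J ∷ a ∷ [])))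

  module _ (J-large : a + a + a + 3 ≤ J) where

    -- The clusters r₀, r₁, r₂ around v, v + (J + s), v + 2 (J + s) are translated by
    -- 2J, J and 0 onto one window of width 2s.
    fold : ℕ → ℕ
    fold x with x ≤? a + a
    ... | yes _ = x + J + J
    ... | no _ with x ≤? J + a + a + a + 1
    ...   | yes _ = x + J
    ...   | no _ = x

    fold-r₀ : ∀ {x} → x ≤ a + a → fold x ≡ x + J + J
    fold-r₀ {x} x≤2a with x ≤? a + a
    ... | yes _ = refl
    ... | no x≰2a = ⊥-elim (x≰2a x≤2a)

    fold-r₁ : ∀ {x} → J + a < x → x ≤ J + a + a + a + 1 → fold x ≡ x + J
    fold-r₁ {x} lower upper with x ≤? a + a
    ... | yes x≤2a = ⊥-elim (lin-⊥ (a + a + 3) (x≤2a +ᵐ lower +ᵐ J-large) (solve (x ∷ J ∷ a ∷ [])))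
    ... | no _ with x ≤? J + a + a + a + 1
    ...   | yes _ = refl
    ...   | no x≰ = ⊥-elim (x≰ upper)

    fold-r₂ : ∀ {x} → J + J + a + 1 < x → fold x ≡ x
    fold-r₂ {x} lower with x ≤? a + a
    ... | yes x≤2a = ⊥-elim (lin-⊥ (J + a + a + 4) (x≤2a +ᵐ lower +ᵐ J-large) (solve (x ∷ J ∷ a ∷ [])))
    ... | no _ with x ≤? J + a + a + a + 1
    ...   | yes x≤ = ⊥-elim (lin-⊥ (a + 3) (x≤ +ᵐ lower +ᵐ J-large) (solve (x ∷ J ∷ a ∷ [])))
    ...   | no _ = refl

    fold-close : ∀ {x y d} → x + d ≡ y → 0 < d → Region x → Region y → Window d →
      Close (a + a + 2) (fold x) (fold y)
    fold-close {x} {y} {d} x+d≡y 0<d (r₀ p) (r₀ q) _ rewrite fold-r₀ p | fold-r₀ q =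
      inj₁ ( lin-≤ 0 (0<d +ᵐ ≤-reflexive x+d≡y) (solve (x ∷ y ∷ d ∷ J ∷ [])) ,
             lin-≤ (x + 2) q (solve (x ∷ y ∷ J ∷ a ∷ [])) )
    fold-close {x} {y} {d} x+d≡y _ (r₀ p) (r₁ l u) (w₀ d≤a) = ⊥-elim
      (lin-⊥ (a + 3) (d≤a +ᵐ ≤-reflexive (sym x+d≡y) +ᵐ p +ᵐ l +ᵐ J-large) (solve (x ∷ y ∷ d ∷ J ∷ a ∷ [])))
    fold-close {x} {y} {d} x+d≡y _ (r₀ p) (r₁ l u) (w₀⁻ d-large) = ⊥-elim
      (lin-⊥ (J + a + x + 4) (d-large +ᵐ u +ᵐ ≤-reflexive x+d≡y +ᵐ J-large) (solve (x ∷ y ∷ d ∷ J ∷ a ∷ [])))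
    fold-close {x} {y} {d} x+d≡y _ (r₀ p) (r₁ l u) (w₂ lower _) = ⊥-elim
      (lin-⊥ (x + 3) (lower +ᵐ u +ᵐ ≤-reflexive x+d≡y +ᵐ J-large) (solve (x ∷ y ∷ d ∷ J ∷ a ∷ [])))
    fold-close {x} {y} {d} x+d≡y _ (r₀ p) (r₁ l u) (w₁ lower upper) rewrite fold-r₀ p | fold-r₁ l u =
      inj₁ ( lin-≤ 0 (lower +ᵐ ≤-reflexive x+d≡y) (solve (x ∷ y ∷ d ∷ J ∷ [])) ,
             lin-≤ 1 (upper +ᵐ ≤-reflexive (sym x+d≡y)) (solve (x ∷ y ∷ d ∷ J ∷ a ∷ [])) )
    fold-close {x} {y} {d} x+d≡y _ (r₀ p) (r₂ l u) (w₀ d≤a) = ⊥-elim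
      (lin-⊥ (J + a + 4) (d≤a +ᵐ ≤-reflexive (sym x+d≡y) +ᵐ p +ᵐ l +ᵐ J-large) (solve (x ∷ y ∷ d ∷ J ∷ a ∷ [])))
    fold-close {x} {y} {d} x+d≡y _ (r₀ p) (r₂ l u) (w₀⁻ d-large) = ⊥-elim
      (lin-⊥ (a + x + 3) (d-large +ᵐ u +ᵐ ≤-reflexive x+d≡y +ᵐ J-large) (solve (x ∷ y ∷ d ∷ J ∷ a ∷ [])))
    fold-close {x} {y} {d} x+d≡y _ (r₀ p) (r₂ l u) (w₁ _ upper) = ⊥-elim
      (lin-⊥ 3 (upper +ᵐ ≤-reflexive (sym x+d≡y) +ᵐ p +ᵐ l +ᵐ J-large) (solve (x ∷ y ∷ d ∷ J ∷ a ∷ [])))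
    fold-close {x} {y} {d} x+d≡y _ (r₀ p) (r₂ l u) (w₂ lower upper) rewrite fold-r₀ p | fold-r₂ l =
      inj₁ ( lin-≤ 1 (lower +ᵐ ≤-reflexive x+d≡y) (solve (x ∷ y ∷ d ∷ J ∷ [])) ,
             lin-≤ 0 (upper +ᵐ ≤-reflexive (sym x+d≡y)) (solve (x ∷ y ∷ d ∷ J ∷ a ∷ [])) )
    fold-close {x} {y} {d} x+d≡y _ (r₁ l u) (r₀ q) _ = ⊥-elim
      (lin-⊥ (a + a + d + 3) (q +ᵐ l +ᵐ ≤-reflexive x+d≡y +ᵐ J-large) (solve (x ∷ y ∷ d ∷ J ∷ a ∷ [])))
    fold-close {x} {y} {d} x+d≡y 0<d (r₁ l u) (r₁ l′ u′) _ rewrite fold-r₁ l u | fold-r₁ l′ u′ =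
      inj₁ ( lin-≤ 0 (0<d +ᵐ ≤-reflexive x+d≡y) (solve (x ∷ y ∷ d ∷ J ∷ [])) ,
             lin-≤ 2 (u′ +ᵐ l) (solve (x ∷ y ∷ J ∷ a ∷ [])) )
    fold-close {x} {y} {d} x+d≡y _ (r₁ l u) (r₂ l′ u′) (w₀ d≤a) = ⊥-elim
      (lin-⊥ 3 (d≤a +ᵐ ≤-reflexive (sym x+d≡y) +ᵐ u +ᵐ l′ +ᵐ J-large) (solve (x ∷ y ∷ d ∷ J ∷ a ∷ [])))
    fold-close {x} {y} {d} x+d≡y _ (r₁ l u) (r₂ l′ u′) (w₀⁻ d-large) = ⊥-elim
      (lin-⊥ (a + x + 3) (d-large +ᵐ u′ +ᵐ ≤-reflexive x+d≡y +ᵐ J-large) (solve (x ∷ y ∷ d ∷ J ∷ a ∷ [])))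
    fold-close {x} {y} {d} x+d≡y _ (r₁ l u) (r₂ l′ u′) (w₂ lower _) = ⊥-elim
      (lin-⊥ (a + 3) (lower +ᵐ l +ᵐ u′ +ᵐ ≤-reflexive x+d≡y +ᵐ J-large) (solve (x ∷ y ∷ d ∷ J ∷ a ∷ [])))
    fold-close {x} {y} {d} x+d≡y _ (r₁ l u) (r₂ l′ u′) (w₁ lower upper) rewrite fold-r₁ l u | fold-r₂ l′ =
      inj₁ ( lin-≤ 0 (lower +ᵐ ≤-reflexive x+d≡y) (solve (x ∷ y ∷ d ∷ J ∷ [])) ,
             lin-≤ 1 (upper +ᵐ ≤-reflexive (sym x+d≡y)) (solve (x ∷ y ∷ d ∷ J ∷ a ∷ [])) )
    fold-close {x} {y} {d} x+d≡y _ (r₂ l u) (r₀ q) _ = ⊥-elim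
      (lin-⊥ (J + a + a + d + 4) (q +ᵐ l +ᵐ ≤-reflexive x+d≡y +ᵐ J-large) (solve (x ∷ y ∷ d ∷ J ∷ a ∷ [])))
    fold-close {x} {y} {d} x+d≡y _ (r₂ l u) (r₁ l′ u′) _ = ⊥-elim
      (lin-⊥ (a + d + 3) (u′ +ᵐ l +ᵐ ≤-reflexive x+d≡y +ᵐ J-large) (solve (x ∷ y ∷ d ∷ J ∷ a ∷ [])))
    fold-close {x} {y} {d} x+d≡y 0<d (r₂ l u) (r₂ l′ u′) _ rewrite fold-r₂ l | fold-r₂ l′ =
      inj₁ ( lin-≤ 0 (0<d +ᵐ ≤-reflexive x+d≡y) (solve (x ∷ y ∷ d ∷ [])) ,
             lin-≤ 2 (u′ +ᵐ l) (solve (x ∷ y ∷ J ∷ a ∷ [])) )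

    folding : Folding n J a
    folding = record
      { Window = Window ; Region = Region ; window = window
      ; region-near = region-near ; region = region
      ; fold = fold ; spread = a + a + 2 ; fold-close = fold-close }

module Case-2k-1 {n J a : ℕ} (n≡ : n ≡ J + J + J + a + 2) (J-large : a + a + a + 3 ≤ J) where

  data Window (d : ℕ) : Set where
    w₀  : d ≤ a → Window d
    w₀⁻ : J + J + J + 1 < d → Window d
    w₁  : J ≤ d + a → d ≤ J + a + 1 → Window d
    w₂  : J + J < d → d ≤ J + J + a + a + 2 → Window d

  window : ∀ {d} → TwoStep n J (suc a) d → Window d
  window {d} (S¹ (J<d , d≤J+s)) =
    w₁ (lin-≤ (a + 1) J<d (solve (d ∷ J ∷ a ∷ []))) (lin-≤ 0 d≤J+s (solve (d ∷ J ∷ a ∷ [])))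
  window {d} (S¹⁻ e (J<e , e≤J+s) d+e≡n) =
    w₂ (lin-≤ 0 (e≤J+s +ᵐ ≤-reflexive (sym d+e≡n) +ᵐ ≤-reflexive (sym n≡)) (solve (d ∷ e ∷ n ∷ J ∷ a ∷ [])))
       (lin-≤ (a + 1) (J<e +ᵐ ≤-reflexive d+e≡n +ᵐ ≤-reflexive n≡) (solve (d ∷ e ∷ n ∷ J ∷ a ∷ [])))
  window {d} (S² e₁ e₂ (J<e₁ , e₁≤J+s) (J<e₂ , e₂≤J+s) d≡e₁+e₂) =
    w₂ (lin-≤ 1 (J<e₁ +ᵐ J<e₂ +ᵐ ≤-reflexive (sym d≡e₁+e₂)) (solve (d ∷ e₁ ∷ e₂ ∷ J ∷ [])))
       (lin-≤ 0 (e₁≤J+s +ᵐ e₂≤J+s +ᵐ ≤-reflexive d≡e₁+e₂) (solve (d ∷ e₁ ∷ e₂ ∷ J ∷ a ∷ [])))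
  window {d} (S²⁻ e₁ e₂ (J<e₁ , e₁≤J+s) (J<e₂ , e₂≤J+s) d+e≡n) =
    w₁ (lin-≤ 0 (e₁≤J+s +ᵐ e₂≤J+s +ᵐ ≤-reflexive (sym d+e≡n) +ᵐ ≤-reflexive (sym n≡))
         (solve (d ∷ e₁ ∷ e₂ ∷ n ∷ J ∷ a ∷ [])))
       (lin-≤ 1 (J<e₁ +ᵐ J<e₂ +ᵐ ≤-reflexive d+e≡n +ᵐ ≤-reflexive n≡)
         (solve (d ∷ e₁ ∷ e₂ ∷ n ∷ J ∷ a ∷ [])))
  window (S⁰ d<s) = w₀ (m<1+n⇒m≤n d<s)
  window {d} (S⁰⁻ n<d+s) = w₀⁻ (lin-≤ 0 (n<d+s +ᵐ ≤-reflexive (sym n≡)) (solve (d ∷ n ∷ J ∷ a ∷ [])))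

  a<n : a < n
  a<n = lin-≤ (J + J + J + 1) (≤-reflexive (sym n≡)) (solve (n ∷ J ∷ a ∷ []))

  S+S<n : J + suc a + (J + suc a) < n
  S+S<n = lin-≤ (a + a + 2) (≤-reflexive (sym n≡) +ᵐ J-large) (solve (n ∷ J ∷ a ∷ []))

  data Region (x : ℕ) : Set where
    r₀ : x ≤ a + a → Region x
    r₁ : J ≤ x → x ≤ J + a + a + 1 → Region x
    r₂ : J + J + a < x → x ≤ J + J + a + a + a + 2 → Region x

  region-near : ∀ {x} → x ≤ a → Region x
  region-near {x} x≤a = r₀ (lin-≤ a x≤a (solve (x ∷ a ∷ [])))

  region : ∀ {x d} → x < n → a + d ≡ x → Window d → Region x
  region {x} {d} _ a+d≡x (w₀ d≤a) = r₀ (lin-≤ 0 (d≤a +ᵐ ≤-reflexive (sym a+d≡x)) (solve (x ∷ d ∷ a ∷ [])))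
  region {x} {d} x<n a+d≡x (w₀⁻ d-large) = ⊥-elim
    (lin-⊥ 0 (d-large +ᵐ x<n +ᵐ ≤-reflexive a+d≡x +ᵐ ≤-reflexive n≡) (solve (x ∷ d ∷ n ∷ J ∷ a ∷ [])))
  region {x} {d} _ a+d≡x (w₁ lower upper) =
    r₁ (lin-≤ 0 (lower +ᵐ ≤-reflexive a+d≡x) (solve (x ∷ d ∷ J ∷ a ∷ [])))
       (lin-≤ 0 (upper +ᵐ ≤-reflexive (sym a+d≡x)) (solve (x ∷ d ∷ J ∷ a ∷ [])))
  region {x} {d} _ a+d≡x (w₂ lower upper) =
    r₂ (lin-≤ 0 (lower +ᵐ ≤-reflexive a+d≡x) (solve (x ∷ d ∷ J ∷ a ∷ [])))
       (lin-≤ 0 (upper +ᵐ ≤-reflexive (sym a+d≡x)) (solve (x ∷ d ∷ J ∷ a ∷ [])))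

  -- As for n = 3J + 2s + 1, now with translations by multiples of J + s + 1.
  fold : ℕ → ℕ
  fold x with x ≤? a + a
  ... | yes _ = x + (J + a + 2) + (J + a + 2)
  ... | no _ with x ≤? J + a + a + 1
  ...   | yes _ = x + (J + a + 2)
  ...   | no _ = x

  fold-r₀ : ∀ {x} → x ≤ a + a → fold x ≡ x + (J + a + 2) + (J + a + 2)
  fold-r₀ {x} x≤2a with x ≤? a + a
  ... | yes _ = refl
  ... | no x≰2a = ⊥-elim (x≰2a x≤2a)

  fold-r₁ : ∀ {x} → J ≤ x → x ≤ J + a + a + 1 → fold x ≡ x + (J + a + 2)
  fold-r₁ {x} lower upper with x ≤? a + a
  ... | yes x≤2a = ⊥-elim (lin-⊥ (a + 2) (x≤2a +ᵐ lower +ᵐ J-large) (solve (x ∷ J ∷ a ∷ [])))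
  ... | no _ with x ≤? J + a + a + 1
  ...   | yes _ = refl
  ...   | no x≰ = ⊥-elim (x≰ upper)

  fold-r₂ : ∀ {x} → J + J + a < x → fold x ≡ x
  fold-r₂ {x} lower with x ≤? a + a
  ... | yes x≤2a = ⊥-elim (lin-⊥ (J + a + a + 3) (x≤2a +ᵐ lower +ᵐ J-large) (solve (x ∷ J ∷ a ∷ [])))
  ... | no _ with x ≤? J + a + a + 1
  ...   | yes x≤ = ⊥-elim (lin-⊥ (a + a + 2) (x≤ +ᵐ lower +ᵐ J-large) (solve (x ∷ J ∷ a ∷ [])))
  ...   | no _ = refl

  fold-close : ∀ {x y d} → x + d ≡ y → 0 < d → Region x → Region y → Window d →
    Close (a + a + 3) (fold x) (fold y)
  fold-close {x} {y} {d} x+d≡y 0<d (r₀ p) (r₀ q) _ rewrite fold-r₀ p | fold-r₀ q =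
    inj₁ ( lin-≤ 0 (0<d +ᵐ ≤-reflexive x+d≡y) (solve (x ∷ y ∷ d ∷ J ∷ a ∷ [])) ,
           lin-≤ (x + 3) q (solve (x ∷ y ∷ J ∷ a ∷ [])) )
  fold-close {x} {y} {d} x+d≡y _ (r₀ p) (r₁ l u) (w₀ d≤a) = ⊥-elim
    (lin-⊥ 2 (d≤a +ᵐ ≤-reflexive (sym x+d≡y) +ᵐ p +ᵐ l +ᵐ J-large) (solve (x ∷ y ∷ d ∷ J ∷ a ∷ [])))
  fold-close {x} {y} {d} x+d≡y _ (r₀ p) (r₁ l u) (w₀⁻ d-large) = ⊥-elim
    (lin-⊥ (J + a + x + 3) (d-large +ᵐ ≤-reflexive x+d≡y +ᵐ u +ᵐ J-large) (solve (x ∷ y ∷ d ∷ J ∷ a ∷ [])))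
  fold-close {x} {y} {d} x+d≡y _ (r₀ p) (r₁ l u) (w₂ lower _) = ⊥-elim
    (lin-⊥ (a + x + 2) (lower +ᵐ ≤-reflexive x+d≡y +ᵐ u +ᵐ J-large) (solve (x ∷ y ∷ d ∷ J ∷ a ∷ [])))
  fold-close {x} {y} {d} x+d≡y _ (r₀ p) (r₁ l u) (w₁ lower upper) rewrite fold-r₀ p | fold-r₁ l u =
    inj₂ ( lin-≤ 0 (upper +ᵐ ≤-reflexive (sym x+d≡y)) (solve (x ∷ y ∷ d ∷ J ∷ a ∷ [])) ,
           lin-≤ 1 (lower +ᵐ ≤-reflexive x+d≡y) (solve (x ∷ y ∷ d ∷ J ∷ a ∷ [])) )
  fold-close {x} {y} {d} x+d≡y _ (r₀ p) (r₂ l u) (w₀ d≤a) = ⊥-elim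
    (lin-⊥ (J + a + 3) (d≤a +ᵐ ≤-reflexive (sym x+d≡y) +ᵐ p +ᵐ l +ᵐ J-large) (solve (x ∷ y ∷ d ∷ J ∷ a ∷ [])))
  fold-close {x} {y} {d} x+d≡y _ (r₀ p) (r₂ l u) (w₀⁻ d-large) = ⊥-elim
    (lin-⊥ (x + 2) (d-large +ᵐ ≤-reflexive x+d≡y +ᵐ u +ᵐ J-large) (solve (x ∷ y ∷ d ∷ J ∷ a ∷ [])))
  fold-close {x} {y} {d} x+d≡y _ (r₀ p) (r₂ l u) (w₁ _ upper) = ⊥-elim
    (lin-⊥ (a + 2) (upper +ᵐ ≤-reflexive (sym x+d≡y) +ᵐ p +ᵐ l +ᵐ J-large) (solve (x ∷ y ∷ d ∷ J ∷ a ∷ [])))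
  fold-close {x} {y} {d} x+d≡y _ (r₀ p) (r₂ l u) (w₂ lower upper) rewrite fold-r₀ p | fold-r₂ l =
    inj₂ ( lin-≤ 1 (upper +ᵐ ≤-reflexive (sym x+d≡y)) (solve (x ∷ y ∷ d ∷ J ∷ a ∷ [])) ,
           lin-≤ 0 (lower +ᵐ ≤-reflexive x+d≡y) (solve (x ∷ y ∷ d ∷ J ∷ a ∷ [])) )
  fold-close {x} {y} {d} x+d≡y _ (r₁ l u) (r₀ q) _ = ⊥-elim
    (lin-⊥ (a + d + 2) (q +ᵐ l +ᵐ ≤-reflexive x+d≡y +ᵐ J-large) (solve (x ∷ y ∷ d ∷ J ∷ a ∷ [])))
  fold-close {x} {y} {d} x+d≡y 0<d (r₁ l u) (r₁ l′ u′) _ rewrite fold-r₁ l u | fold-r₁ l′ u′ =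
    inj₁ ( lin-≤ 0 (0<d +ᵐ ≤-reflexive x+d≡y) (solve (x ∷ y ∷ d ∷ J ∷ a ∷ [])) ,
           lin-≤ 2 (u′ +ᵐ l) (solve (x ∷ y ∷ J ∷ a ∷ [])) )
  fold-close {x} {y} {d} x+d≡y _ (r₁ l u) (r₂ l′ u′) (w₀ d≤a) = ⊥-elim
    (lin-⊥ (a + 2) (d≤a +ᵐ ≤-reflexive (sym x+d≡y) +ᵐ u +ᵐ l′ +ᵐ J-large) (solve (x ∷ y ∷ d ∷ J ∷ a ∷ [])))
  fold-close {x} {y} {d} x+d≡y _ (r₁ l u) (r₂ l′ u′) (w₀⁻ d-large) = ⊥-elim
    (lin-⊥ (x + 2) (d-large +ᵐ ≤-reflexive x+d≡y +ᵐ u′ +ᵐ J-large) (solve (x ∷ y ∷ d ∷ J ∷ a ∷ [])))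
  fold-close {x} {y} {d} x+d≡y _ (r₁ l u) (r₂ l′ u′) (w₂ lower _) = ⊥-elim
    (lin-⊥ 1 (lower +ᵐ l +ᵐ ≤-reflexive x+d≡y +ᵐ u′ +ᵐ J-large) (solve (x ∷ y ∷ d ∷ J ∷ a ∷ [])))
  fold-close {x} {y} {d} x+d≡y _ (r₁ l u) (r₂ l′ u′) (w₁ lower upper) rewrite fold-r₁ l u | fold-r₂ l′ =
    inj₂ ( lin-≤ 0 (upper +ᵐ ≤-reflexive (sym x+d≡y)) (solve (x ∷ y ∷ d ∷ J ∷ a ∷ [])) ,
           lin-≤ 1 (lower +ᵐ ≤-reflexive x+d≡y) (solve (x ∷ y ∷ d ∷ J ∷ a ∷ [])) )
  fold-close {x} {y} {d} x+d≡y _ (r₂ l u) (r₀ q) _ = ⊥-elim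
    (lin-⊥ (J + a + a + d + 3) (q +ᵐ l +ᵐ ≤-reflexive x+d≡y +ᵐ J-large) (solve (x ∷ y ∷ d ∷ J ∷ a ∷ [])))
  fold-close {x} {y} {d} x+d≡y _ (r₂ l u) (r₁ l′ u′) _ = ⊥-elim
    (lin-⊥ (a + a + d + 2) (u′ +ᵐ l +ᵐ ≤-reflexive x+d≡y +ᵐ J-large) (solve (x ∷ y ∷ d ∷ J ∷ a ∷ [])))
  fold-close {x} {y} {d} x+d≡y 0<d (r₂ l u) (r₂ l′ u′) _ rewrite fold-r₂ l | fold-r₂ l′ =
    inj₁ ( lin-≤ 0 (0<d +ᵐ ≤-reflexive x+d≡y) (solve (x ∷ y ∷ d ∷ [])) ,
           lin-≤ 2 (u′ +ᵐ l) (solve (x ∷ y ∷ J ∷ a ∷ [])) )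

  folding : Folding n J a
  folding = record
    { Window = Window ; Region = Region ; window = window
    ; region-near = region-near ; region = region
    ; fold = fold ; spread = a + a + 3 ; fold-close = fold-close }

module Case-k=4 {n a : ℕ} (n≡ : n ≡ (a + a + 2) + (a + a + 2) + (a + a + 2) + a + a + 3) where

  open Case-2k-2 {n} {a + a + 2} {a} n≡ public
    using (Window; w₀; w₀⁻; w₁; w₂; window; Region; r₀; r₁; r₂; region-near; region)

  Far : ℕ → Set
  Far x = a + a + a + 2 < x × x ≤ a + a + a + a + a + a + a + 6

  near-or-far : ∀ {x} → Region x → x ≤ a + a ⊎ Far x
  near-or-far (r₀ x≤2a) = inj₁ x≤2a
  near-or-far {x} (r₁ lower upper) =
    inj₂ (lin-≤ 0 lower (solve (x ∷ a ∷ [])) , lin-≤ (a + a + 3) upper (solve (x ∷ a ∷ [])))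
  near-or-far {x} (r₂ lower upper) =
    inj₂ (lin-≤ (a + a + 3) lower (solve (x ∷ a ∷ [])) , lin-≤ 0 upper (solve (x ∷ a ∷ [])))

  far-before-near : ∀ {x y} → a + a + a + 2 < x → x ≤ y → y ≤ a + a → ⊥
  far-before-near {x} {y} far x≤y near = lin-⊥ (a + 2) (far +ᵐ x≤y +ᵐ near) (solve (x ∷ y ∷ a ∷ []))

  near-cluster : ∀ {x y d} → x + d ≡ y → y ≤ a + a → Window d → y ≤ x + a
  near-cluster {x} {y} {d} x+d≡y _ (w₀ d≤a) =
    lin-≤ 0 (≤-reflexive (sym x+d≡y) +ᵐ d≤a) (solve (x ∷ y ∷ d ∷ a ∷ []))
  near-cluster {x} {y} {d} x+d≡y near (w₀⁻ d-large) = ⊥-elim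
    (lin-⊥ (a + a + a + a + a + x + 8) (d-large +ᵐ ≤-reflexive x+d≡y +ᵐ near) (solve (x ∷ y ∷ d ∷ a ∷ [])))
  near-cluster {x} {y} {d} x+d≡y near (w₁ lower _) = ⊥-elim
    (lin-⊥ (x + 2) (lower +ᵐ ≤-reflexive x+d≡y +ᵐ near) (solve (x ∷ y ∷ d ∷ a ∷ [])))
  near-cluster {x} {y} {d} x+d≡y near (w₂ lower _) = ⊥-elim
    (lin-⊥ (a + a + x + 5) (lower +ᵐ ≤-reflexive x+d≡y +ᵐ near) (solve (x ∷ y ∷ d ∷ a ∷ [])))

  near-to-far : ∀ {x y d} → x + d ≡ y → x ≤ a + a → Far y → Window d →
    x + a + a + 2 < y × y ≤ x + (a + a + a + a + a + a + 6)
  near-to-far {x} {y} {d} x+d≡y near (far , _) (w₀ d≤a) = ⊥-elim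
    (lin-⊥ 2 (d≤a +ᵐ ≤-reflexive (sym x+d≡y) +ᵐ near +ᵐ far) (solve (x ∷ y ∷ d ∷ a ∷ [])))
  near-to-far {x} {y} {d} x+d≡y _ (_ , far) (w₀⁻ d-large) = ⊥-elim
    (lin-⊥ (x + 2) (d-large +ᵐ ≤-reflexive x+d≡y +ᵐ far) (solve (x ∷ y ∷ d ∷ a ∷ [])))
  near-to-far {x} {y} {d} x+d≡y _ _ (w₁ lower upper) =
    lin-≤ 0 (lower +ᵐ ≤-reflexive x+d≡y) (solve (x ∷ y ∷ d ∷ a ∷ [])) ,
    lin-≤ (a + a + 3) (upper +ᵐ ≤-reflexive (sym x+d≡y)) (solve (x ∷ y ∷ d ∷ a ∷ []))
  near-to-far {x} {y} {d} x+d≡y _ _ (w₂ lower upper) =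
    lin-≤ (a + a + 3) (lower +ᵐ ≤-reflexive x+d≡y) (solve (x ∷ y ∷ d ∷ a ∷ [])) ,
    lin-≤ 0 (upper +ᵐ ≤-reflexive (sym x+d≡y)) (solve (x ∷ y ∷ d ∷ a ∷ []))

  far-cluster-or-gap : ∀ {x y d} → x + d ≡ y → a + a + a + 2 < x → y ≤ a + a + a + a + a + a + a + 6 →
    Window d → y ≤ x + a ⊎ x + a + a + 2 < y
  far-cluster-or-gap {x} {y} {d} x+d≡y _ _ (w₀ d≤a) =
    inj₁ (lin-≤ 0 (≤-reflexive (sym x+d≡y) +ᵐ d≤a) (solve (x ∷ y ∷ d ∷ a ∷ [])))
  far-cluster-or-gap {x} {y} {d} x+d≡y _ far (w₀⁻ d-large) = ⊥-elim
    (lin-⊥ (x + 2) (d-large +ᵐ ≤-reflexive x+d≡y +ᵐ far) (solve (x ∷ y ∷ d ∷ a ∷ [])))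
  far-cluster-or-gap {x} {y} {d} x+d≡y _ _ (w₁ lower _) =
    inj₂ (lin-≤ 0 (lower +ᵐ ≤-reflexive x+d≡y) (solve (x ∷ y ∷ d ∷ a ∷ [])))
  far-cluster-or-gap {x} {y} {d} x+d≡y far₁ far₂ (w₂ lower _) = ⊥-elim
    (lin-⊥ 2 (lower +ᵐ far₁ +ᵐ ≤-reflexive x+d≡y +ᵐ far₂) (solve (x ∷ y ∷ d ∷ a ∷ [])))

  high-not-near : ∀ {w z} → a + a + a + 2 < w → w + a + a + 2 < z → z ≤ a + a → ⊥
  high-not-near {w} {z} far w≪z near = lin-⊥ (a + a + a + 5) (far +ᵐ w≪z +ᵐ near) (solve (w ∷ z ∷ a ∷ []))

  near<far : ∀ {x y} → x ≤ a + a → Far y → x < y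
  near<far {x} {y} near (far , _) = lin-≤ (a + 2) (near +ᵐ far) (solve (x ∷ y ∷ a ∷ []))

  gap-below : ∀ {w y z} → w + a + a + 2 < z → z ≤ y + a → w < y
  gap-below {w} {y} {z} w≪z z≤y+a = lin-≤ (a + 2) (w≪z +ᵐ z≤y+a) (solve (w ∷ y ∷ z ∷ a ∷ []))

  no-double-cluster : ∀ {w y z} → w + a + a + 2 < z → z ≤ y + a → y ≤ w + a → ⊥
  no-double-cluster {w} {y} {z} w≪z z≤y+a y≤w+a =
    lin-⊥ 2 (w≪z +ᵐ z≤y+a +ᵐ y≤w+a) (solve (w ∷ y ∷ z ∷ a ∷ []))

  close-near-near : ∀ {x y} → x < y → y ≤ x + a →
    Close (a + a + 2) (x + (a + a + a + a + 4)) (y + (a + a + a + a + 4))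
  close-near-near {x} {y} x<y y≤x+a =
    Close-shift {a + a + 2} {x} {y} (a + a + a + a + 4) (inj₁ (x<y , lin-≤ (a + 2) y≤x+a (solve (x ∷ y ∷ a ∷ []))))

  close-near-high : ∀ {x w y} → x + a + a + 2 < w → w + a + a + 2 < y →
    y ≤ x + (a + a + a + a + a + a + 6) → Close (a + a + 2) (x + (a + a + a + a + 4)) y
  close-near-high {x} {w} {y} x≪w w≪y y≤x+6s =
    inj₁ (lin-≤ 1 (x≪w +ᵐ w≪y) (solve (x ∷ w ∷ y ∷ a ∷ [])) , lin-≤ 0 y≤x+6s (solve (x ∷ y ∷ a ∷ [])))

  close-near-low : ∀ {x y y₂} → x + a + a + 2 < y → y + a + a + 2 < y₂ →
    y₂ ≤ x + (a + a + a + a + a + a + 6) →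
    Close (a + a + 2) (x + (a + a + a + a + 4)) (y + (a + a + 2))
  close-near-low {x} {y} {y₂} x≪y y≪y₂ y₂≤x+6s =
    inj₁ (lin-≤ 0 x≪y (solve (x ∷ y ∷ a ∷ [])) , lin-≤ 1 (y≪y₂ +ᵐ y₂≤x+6s) (solve (x ∷ y ∷ y₂ ∷ a ∷ [])))

  close-low-low : ∀ {x y} → x < y → y ≤ x + a + a + 2 →
    Close (a + a + 2) (x + (a + a + 2)) (y + (a + a + 2))
  close-low-low {x} {y} x<y y≤ =
    Close-shift {a + a + 2} {x} {y} (a + a + 2) (inj₁ (x<y , lin-≤ 0 y≤ (solve (x ∷ y ∷ a ∷ []))))

  close-low-high : ∀ {x y} → a + a + a + 2 < x → x + a + a + 2 < y → y ≤ a + a + a + a + a + a + a + 6 →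
    Close (a + a + 2) (x + (a + a + 2)) y
  close-low-high {x} {y} far x≪y y≤7s =
    inj₁ (lin-≤ 0 x≪y (solve (x ∷ y ∷ a ∷ [])) , lin-≤ 1 (far +ᵐ y≤7s) (solve (x ∷ y ∷ a ∷ [])))

  close-high-high : ∀ {w x y} → a + a + a + 2 < w → w + a + a + 2 < x → x < y →
    y ≤ a + a + a + a + a + a + a + 6 → Close (a + a + 2) x y
  close-high-high {w} {x} {y} far w≪x x<y y≤7s =
    inj₁ (x<y , lin-≤ 2 (far +ᵐ w≪x +ᵐ y≤7s) (solve (w ∷ x ∷ y ∷ a ∷ [])))

module Case-k=4-bound {n a : ℕ} .{{_ : NonZero n}}
  (n≡ : n ≡ (a + a + 2) + (a + a + 2) + (a + a + 2) + a + a + 3)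
  (V : Subset n) (v : Fin n) (v∈V : v ∈ V) (a<n : a < n)
  (two-step : ∀ y z → y ∈ V → z ∈ V → y ≢ z → TwoStep n (a + a + 2) (suc a) (Circular.δ n z y)) where

  open Circular n
  open Around V v v∈V a<n two-step
  open Case-k=4 {n} {a} n≡

  near-or-far-at : ∀ y → y ∈ V → r y ≤ a + a ⊎ Far (r y)
  near-or-far-at y y∈V = near-or-far (position window region-near region y y∈V)

  window-between : ∀ y z → y ∈ V → z ∈ V → r y ≤ r z → y ≢ z →
    Σ[ d ∈ ℕ ] r y + d ≡ r z × 0 < d × Window d
  window-between y z y∈V z∈V ry≤rz y≢z with pair y z y∈V z∈V ry≤rz y≢z
  ... | d , ry+d≡rz , 0<d , t = d , ry+d≡rz , 0<d , window t

  -- If some vertex is high, near, low and high vertices are folded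
  -- by 4s, 2s and 0; otherwise the near and the far vertices form two clusters.
  High : ℕ → Set
  High x = Σ[ w ∈ Fin n ] w ∈ V × Far (r w) × r w + a + a + 2 < x

  High? : ∀ x → Dec (High x)
  High? x = any? λ w → w ∈? V ×-dec ((a + a + a + 2 <? r w ×-dec r w ≤? a + a + a + a + a + a + a + 6)
                                     ×-dec r w + a + a + 2 <? x)

  ∣V∣≤-no-high : (∀ z → z ∈ V → ¬ High (r z)) → ∣ V ∣ ≤ suc a + suc a
  ∣V∣≤-no-high no-high = begin
    ∣ V ∣                                  ≡⟨ ∣p∣≡∣p∩q∣+∣p∩∁q∣ V Near ⟩
    ∣ V ∩ Near ∣ + ∣ V ∩ ∁ Near ∣          ≤⟨ ∣W∣≤-cluster (V ∩ Near) near-part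
                                               +ᵐ ∣W∣≤-cluster (V ∩ ∁ Near) far-part ⟩
    suc a + suc a                          ∎
    where
    open ≤-Reasoning
    Near : Subset n
    Near = subsetOf (λ y → r y ≤? a + a)
    near-part : ∀ y z → y ∈ V ∩ Near → z ∈ V ∩ Near → r y ≤ r z → y ≢ z → r z ≤ r y + a
    near-part y z y∈ z∈ ry≤rz y≢z with x∈p∩q⁻ V Near y∈ | x∈p∩q⁻ V Near z∈
    ... | y∈V , _ | z∈V , z∈Near with window-between y z y∈V z∈V ry≤rz y≢z
    ...   | _ , ry+d≡rz , _ , wd = near-cluster ry+d≡rz (∈subsetOf⁻ _ z∈Near) wd
    far : ∀ y → y ∈ V ∩ ∁ Near → y ∈ V × Far (r y)
    far y y∈ with x∈p∩q⁻ V (∁ Near) y∈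
    ... | y∈V , y∈∁Near with near-or-far-at y y∈V
    ...   | inj₁ near = ⊥-elim (x∈∁p⇒x∉p y∈∁Near (∈subsetOf⁺ _ near))
    ...   | inj₂ far-y = y∈V , far-y
    far-part : ∀ y z → y ∈ V ∩ ∁ Near → z ∈ V ∩ ∁ Near → r y ≤ r z → y ≢ z → r z ≤ r y + a
    far-part y z y∈ z∈ ry≤rz y≢z with far y y∈ | far z z∈
    ... | y∈V , far-y | z∈V , far-z with window-between y z y∈V z∈V ry≤rz y≢z
    ...   | _ , ry+d≡rz , _ , wd with far-cluster-or-gap ry+d≡rz (proj₁ far-y) (proj₂ far-z) wd
    ...     | inj₁ rz≤ry+a = rz≤ry+a
    ...     | inj₂ gap = ⊥-elim (no-high z z∈V (y , y∈V , far-y , gap))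

  window-between< : ∀ y z → y ∈ V → z ∈ V → r y < r z →
    Σ[ d ∈ ℕ ] r y + d ≡ r z × 0 < d × Window d
  window-between< y z y∈V z∈V ry<rz =
    window-between y z y∈V z∈V (<⇒≤ ry<rz) λ y≡z → <-irrefl (cong r y≡z) ry<rz

  high-is-far : ∀ z → z ∈ V → High (r z) → Far (r z)
  high-is-far z z∈V (w , _ , far-w , w≪z) with near-or-far-at z z∈V
  ... | inj₁ near = ⊥-elim (high-not-near (proj₁ far-w) w≪z near)
  ... | inj₂ far-z = far-z

  low-below-high : ∀ y z → y ∈ V → z ∈ V → Far (r y) → ¬ High (r y) → High (r z) →
    r y + a + a + 2 < r z
  low-below-high y z y∈V z∈V far-y ¬high-y high-z@(w , w∈V , far-w , w≪z) with ≤-total (r y) (r z)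
  ... | inj₂ rz≤ry = ⊥-elim (¬high-y (w , w∈V , far-w , <-≤-trans w≪z rz≤ry))
  ... | inj₁ ry≤rz with y ≟ᶠ z
  ...   | yes refl = ⊥-elim (¬high-y high-z)
  ...   | no y≢z with window-between y z y∈V z∈V ry≤rz y≢z
  ...     | _ , ry+d≡rz , _ , wd
          with far-cluster-or-gap ry+d≡rz (proj₁ far-y) (proj₂ (high-is-far z z∈V high-z)) wd
  ...       | inj₂ y≪z = y≪z
  ...       | inj₁ rz≤ry+a with window-between< w y w∈V y∈V (gap-below w≪z rz≤ry+a)
  ...         | _ , rw+d≡ry , _ , wd′ with far-cluster-or-gap rw+d≡ry (proj₁ far-w) (proj₂ far-y) wd′
  ...           | inj₁ ry≤rw+a = ⊥-elim (no-double-cluster w≪z rz≤ry+a ry≤rw+a)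
  ...           | inj₂ w≪y = ⊥-elim (¬high-y (w , w∈V , far-w , w≪y))

  fold : ℕ → ℕ
  fold x with x ≤? a + a
  ... | yes _ = x + (a + a + a + a + 4)
  ... | no _ with High? x
  ...   | yes _ = x
  ...   | no _ = x + (a + a + 2)

  fold-near : ∀ {x} → x ≤ a + a → fold x ≡ x + (a + a + a + a + 4)
  fold-near {x} near with x ≤? a + a
  ... | yes _ = refl
  ... | no ¬near = ⊥-elim (¬near near)

  fold-low : ∀ {x} → Far x → ¬ High x → fold x ≡ x + (a + a + 2)
  fold-low {x} (far , _) ¬high with x ≤? a + a
  ... | yes near = ⊥-elim (far-before-near far ≤-refl near)
  ... | no _ with High? x
  ...   | yes high = ⊥-elim (¬high high)
  ...   | no _ = refl

  fold-high : ∀ {x} → Far x → High x → fold x ≡ x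
  fold-high {x} (far , _) high with x ≤? a + a
  ... | yes near = ⊥-elim (far-before-near far ≤-refl near)
  ... | no _ with High? x
  ...   | yes _ = refl
  ...   | no ¬high = ⊥-elim (¬high high)

  data Class (x : ℕ) : Set where
    near : x ≤ a + a → Class x
    low  : Far x → ¬ High x → Class x
    high : Far x → High x → Class x

  class : ∀ y → y ∈ V → Class (r y)
  class y y∈V with near-or-far-at y y∈V
  ... | inj₁ near-y = near near-y
  ... | inj₂ far-y with High? (r y)
  ...   | yes high-y = high far-y high-y
  ...   | no ¬high-y = low far-y ¬high-y

  near-to-high : ∀ {d} y z → y ∈ V → r y ≤ a + a → Far (r z) → High (r z) → r y + d ≡ r z → Window d →
    Close (a + a + 2) (r y + (a + a + a + a + 4)) (r z)
  near-to-high y z y∈V near-y far-z (w , w∈V , far-w , w≪z) ry+d≡rz wd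
    with window-between< y w y∈V w∈V (near<far near-y far-w)
  ... | _ , ry+d′≡rw , _ , wd′ = close-near-high (proj₁ (near-to-far ry+d′≡rw near-y far-w wd′)) w≪z
                                   (proj₂ (near-to-far ry+d≡rz near-y far-z wd))

  near-to-low : ∀ {d} z₂ → z₂ ∈ V → High (r z₂) → ∀ y z → y ∈ V → z ∈ V →
    r y ≤ a + a → Far (r z) → ¬ High (r z) → r y + d ≡ r z → Window d →
    Close (a + a + 2) (r y + (a + a + a + a + 4)) (r z + (a + a + 2))
  near-to-low z₂ z₂∈V high₂ y z y∈V z∈V near-y far-z ¬high-z ry+d≡rz wd
    with high-is-far z₂ z₂∈V high₂
  ... | far₂ with window-between< y z₂ y∈V z₂∈V (near<far near-y far₂)
  ...   | _ , ry+d₂≡rz₂ , _ , wd₂ =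
    close-near-low (proj₁ (near-to-far ry+d≡rz near-y far-z wd))
      (low-below-high z z₂ z∈V z₂∈V far-z ¬high-z high₂) (proj₂ (near-to-far ry+d₂≡rz₂ near-y far₂ wd₂))

  fold-close : ∀ z₂ → z₂ ∈ V → High (r z₂) →
    ∀ y z → y ∈ V → z ∈ V → r y ≤ r z → y ≢ z → Close (a + a + 2) (fold (r y)) (fold (r z))
  fold-close z₂ z₂∈V high₂ y z y∈V z∈V ry≤rz y≢z
    with window-between y z y∈V z∈V ry≤rz y≢z | class y y∈V | class z z∈V
  ... | _ , ry+d≡rz , 0<d , wd | near p | near q rewrite fold-near p | fold-near q =
    close-near-near (subst (r y <_) ry+d≡rz (m<m+n (r y) 0<d)) (near-cluster ry+d≡rz q wd)
  ... | _ | low (far-y , _) _ | near q = ⊥-elim (far-before-near far-y ry≤rz q)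
  ... | _ | high (far-y , _) _ | near q = ⊥-elim (far-before-near far-y ry≤rz q)
  ... | _ , ry+d≡rz , _ , wd | near p | high far-z high-z rewrite fold-near p | fold-high far-z high-z =
    near-to-high y z y∈V p far-z high-z ry+d≡rz wd
  ... | _ , ry+d≡rz , _ , wd | near p | low far-z ¬high-z rewrite fold-near p | fold-low far-z ¬high-z =
    near-to-low z₂ z₂∈V high₂ y z y∈V z∈V p far-z ¬high-z ry+d≡rz wd
  ... | _ , ry+d≡rz , 0<d , _ | low far-y ¬high-y | low far-z ¬high-z
      rewrite fold-low far-y ¬high-y | fold-low far-z ¬high-z =
    close-low-low (subst (r y <_) ry+d≡rz (m<m+n (r y) 0<d))
      (≮⇒≥ λ y≪z → ¬high-z (y , y∈V , far-y , y≪z))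
  ... | _ | low far-y ¬high-y | high far-z high-z rewrite fold-low far-y ¬high-y | fold-high far-z high-z =
    close-low-high (proj₁ far-y) (low-below-high y z y∈V z∈V far-y ¬high-y high-z) (proj₂ far-z)
  ... | _ | high far-y (w , w∈V , far-w , w≪y) | low far-z ¬high-z =
    ⊥-elim (¬high-z (w , w∈V , far-w , <-≤-trans w≪y ry≤rz))
  ... | _ , ry+d≡rz , 0<d , _ | high far-y high-y@(w , _ , far-w , w≪y) | high far-z high-z
      rewrite fold-high far-y high-y | fold-high far-z high-z =
    close-high-high (proj₁ far-w) w≪y (subst (r y <_) ry+d≡rz (m<m+n (r y) 0<d)) (proj₂ far-z)

  ∣V∣≤2s+1 : ∣ V ∣ ≤ suc (a + a + 2)
  ∣V∣≤2s+1 with any? (λ z → z ∈? V ×-dec High? (r z))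
  ... | yes (z₂ , z₂∈V , high₂) = ∣V∣≤-ordered-close (fold ∘ r) (a + a + 2) (fold-close z₂ z₂∈V high₂)
  ... | no ∄high = ≤-trans (∣V∣≤-no-high λ z z∈V high → ∄high (z , z∈V , high))
                           (lin-≤ 1 (z≤n {0}) (solve (a ∷ [])))

n-formula : ∀ {j a k} c → 3 * j + c ≡ 2 * k →
  suc (2 * suc a * k) ≡ j * suc a + j * suc a + j * suc a + c * suc a + 1
n-formula {j} {a} {k} c 3j+c≡2k = begin
  suc (2 * suc a * k)                                  ≡⟨ cong suc (solve (a ∷ k ∷ [])) ⟩
  suc (suc a * (2 * k))                                ≡⟨ cong (λ t → suc (suc a * t)) 3j+c≡2k ⟨
  suc (suc a * (3 * j + c))                            ≡⟨ solve (j ∷ a ∷ c ∷ []) ⟩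
  j * suc a + j * suc a + j * suc a + c * suc a + 1    ∎
  where open ≡-Reasoning

j≡2∨3≤j : ∀ {j k} → 4 ≤ k → 3 * j + 2 ≡ 2 * k → j ≡ 2 ⊎ 3 ≤ j
j≡2∨3≤j {0} {k} 4≤k eq = ⊥-elim (lin-⊥ 5 (4≤k +ᵐ 4≤k +ᵐ ≤-reflexive (sym eq)) (solve (k ∷ [])))
j≡2∨3≤j {1} {k} 4≤k eq = ⊥-elim (lin-⊥ 2 (4≤k +ᵐ 4≤k +ᵐ ≤-reflexive (sym eq)) (solve (k ∷ [])))
j≡2∨3≤j {2} _ _ = inj₁ refl
j≡2∨3≤j {suc (suc (suc _))} _ _ = inj₂ (s≤s (s≤s (s≤s z≤n)))

3≤j : ∀ {j k} → 4 ≤ k → 3 * j + 1 ≡ 2 * k → 3 ≤ j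
3≤j {0} {k} 4≤k eq = ⊥-elim (lin-⊥ 6 (4≤k +ᵐ 4≤k +ᵐ ≤-reflexive (sym eq)) (solve (k ∷ [])))
3≤j {1} {k} 4≤k eq = ⊥-elim (lin-⊥ 3 (4≤k +ᵐ 4≤k +ᵐ ≤-reflexive (sym eq)) (solve (k ∷ [])))
3≤j {2} {k} 4≤k eq = ⊥-elim (lin-⊥ 0 (4≤k +ᵐ 4≤k +ᵐ ≤-reflexive (sym eq)) (solve (k ∷ [])))
3≤j {suc (suc (suc _))} _ _ = s≤s (s≤s (s≤s z≤n))

3s≤js : ∀ {j a} → 3 ≤ j → a + a + a + 3 ≤ j * suc a
3s≤js {j} {a} 3≤j = ≤-trans (≤-reflexive 3s≡3*s) (*-monoˡ-≤ (suc a) 3≤j)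
  where
  3s≡3*s : a + a + a + 3 ≡ 3 * suc a
  3s≡3*s = solve (a ∷ [])

n≡3J+2s+1 : ∀ {j a k} → 3 * j + 2 ≡ 2 * k →
  suc (2 * suc a * k) ≡ j * suc a + j * suc a + j * suc a + a + a + 3
n≡3J+2s+1 {j} {a} {k} 3j+2≡2k = trans (n-formula {j} {a} {k} 2 3j+2≡2k) (rearrange j a)
  where
  rearrange : ∀ j a → j * suc a + j * suc a + j * suc a + 2 * suc a + 1 ≡
                      j * suc a + j * suc a + j * suc a + a + a + 3
  rearrange = solve-∀

n≡3J+s+1 : ∀ {j a k} → 3 * j + 1 ≡ 2 * k → suc (2 * suc a * k) ≡ j * suc a + j * suc a + j * suc a + a + 2
n≡3J+s+1 {j} {a} {k} 3j+1≡2k = trans (n-formula {j} {a} {k} 1 3j+1≡2k) (rearrange j a)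
  where
  rearrange : ∀ j a → j * suc a + j * suc a + j * suc a + 1 * suc a + 1 ≡
                      j * suc a + j * suc a + j * suc a + a + 2
  rearrange = solve-∀

2s+1≤2s+7 : ∀ a → suc (a + a + 2) ≤ 2 * suc a + 7
2s+1≤2s+7 a = lin-≤ 6 (z≤n {0}) (solve (a ∷ []))

2s+2≤2s+7 : ∀ a → suc (a + a + 3) ≤ 2 * suc a + 7
2s+2≤2s+7 a = lin-≤ 5 (z≤n {0}) (solve (a ∷ []))

∣V∣≤-when-3j+2≡2k : ∀ {k a j} → 4 ≤ k → 3 * j + 2 ≡ 2 * k →
  (H : Subgraph (suc (2 * suc a * k)) (CircleAdj (suc (2 * suc a * k)) (Interval j (suc a)))) →
  DiameterTwo H → ∀ v → v ∈ Subgraph.V H → ∣ Subgraph.V H ∣ ≤ 2 * suc a + 7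
∣V∣≤-when-3j+2≡2k {k} {a} {j} 4≤k 3j+2≡2k H diameter-two v v∈V with j≡2∨3≤j {j} {k} 4≤k 3j+2≡2k
... | inj₂ 3≤j = ≤-trans (∣V∣≤-folding (folding (3s≤js 3≤j))) (2s+1≤2s+7 a)
  where
  open Circular (suc (2 * suc a * k))
  open Case-2k-2 {J = j * suc a} {a = a} (n≡3J+2s+1 {j} {a} {k} 3j+2≡2k)
  open Around (Subgraph.V H) v v∈V a<n (diameter-two⇒TwoStep {j} {suc a} H diameter-two S+S<n)
... | inj₁ refl = ≤-trans (Case-k=4-bound.∣V∣≤2s+1 {a = a} n≡ (Subgraph.V H) v v∈V a<n two-step) (2s+1≤2s+7 a)
  where
  open Circular (suc (2 * suc a * k))
  open Case-2k-2 {J = 2 * suc a} {a = a} (n≡3J+2s+1 {2} {a} {k} 3j+2≡2k) using (a<n; S+S<n)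
  2s≡a+a+2 : ∀ a → 2 * suc a ≡ a + a + 2
  2s≡a+a+2 = solve-∀
  n≡ : suc (2 * suc a * k) ≡ (a + a + 2) + (a + a + 2) + (a + a + 2) + a + a + 3
  n≡ = trans (n≡3J+2s+1 {2} {a} {k} 3j+2≡2k) (cong (λ J → J + J + J + a + a + 3) (2s≡a+a+2 a))
  two-step : ∀ y z → y ∈ Subgraph.V H → z ∈ Subgraph.V H → y ≢ z →
    TwoStep (suc (2 * suc a * k)) (a + a + 2) (suc a) (δ z y)
  two-step y z y∈V z∈V y≢z = subst (λ J → TwoStep (suc (2 * suc a * k)) J (suc a) (δ z y)) (2s≡a+a+2 a)
    (diameter-two⇒TwoStep {2} {suc a} H diameter-two S+S<n y z y∈V z∈V y≢z)

∣V∣≤-when-3j+1≡2k : ∀ {k a j} → 4 ≤ k → 3 * j + 1 ≡ 2 * k →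
  (H : Subgraph (suc (2 * suc a * k)) (CircleAdj (suc (2 * suc a * k)) (Interval j (suc a)))) →
  DiameterTwo H → ∀ v → v ∈ Subgraph.V H → ∣ Subgraph.V H ∣ ≤ 2 * suc a + 7
∣V∣≤-when-3j+1≡2k {k} {a} {j} 4≤k 3j+1≡2k H diameter-two v v∈V =
  ≤-trans (∣V∣≤-folding folding) (2s+2≤2s+7 a)
  where
  open Circular (suc (2 * suc a * k))
  open Case-2k-1 {J = j * suc a} {a = a} (n≡3J+s+1 {j} {a} {k} 3j+1≡2k) (3s≤js (3≤j {j} {k} 4≤k 3j+1≡2k))
  open Around (Subgraph.V H) v v∈V a<n (diameter-two⇒TwoStep {j} {suc a} H diameter-two S+S<n)

≡∸⇒+≡ : ∀ {x y} c → c ≤ y → x ≡ y ∸ c → x + c ≡ y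
≡∸⇒+≡ c c≤y x≡y∸c = trans (cong (_+ c) x≡y∸c) (m∸n+n≡m c≤y)

lemma12 : (k s j : ℕ) → 4 ≤ k → 1 ≤ s →
          (3 * j ≡ 2 * k ∸ 2 ⊎ 3 * j ≡ 2 * k ∸ 1) →
          (H : Subgraph (suc (2 * s * k)) (CircleAdj (suc (2 * s * k)) (Interval j s))) →
          DiameterTwo H →
          ∣ Subgraph.V H ∣ ≤ 2 * s + 7
lemma12 k (suc a) j 4≤k _ shape H diameter-two with nonempty? (Subgraph.V H) | shape
... | no empty | _ = ≤-trans (≤-reflexive (Empty⇒∣p∣≡0 (Subgraph.V H) empty)) z≤n
... | yes (v , v∈V) | inj₁ 3j≡2k∸2 =
  ∣V∣≤-when-3j+2≡2k {k} {a} {j} 4≤k (≡∸⇒+≡ 2 2≤2k 3j≡2k∸2) H diameter-two v v∈V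
  where
  2≤2k : 2 ≤ 2 * k
  2≤2k = lin-≤ (k + 2) 4≤k (solve (k ∷ []))
... | yes (v , v∈V) | inj₂ 3j≡2k∸1 =
  ∣V∣≤-when-3j+1≡2k {k} {a} {j} 4≤k (≡∸⇒+≡ 1 1≤2k 3j≡2k∸1) H diameter-two v v∈V
  where
  1≤2k : 1 ≤ 2 * k
  1≤2k = lin-≤ (k + 3) 4≤k (solve (k ∷ []))
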